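{- Let $r\ge 2$, and let $G_1,G_2$ be finite simple graphs on disjoint vertex sets. Then $\Sigma_r(G_1 * G_2)$ is vertex decomposable if and only if both $\Sigma_r(G_1)$ and $\Sigma_r(G_2)$ are vertex decomposable.
   Context: For a graph $H$, $\Sigma_r(H)$ is the simplicial complex generated by $V(H)\setminus W$ over all $r$-subsets $W\subseteq V(H)$ with $H[W]$ connected (void complex if none). The join $G_1*G_2$ is the graph on $V(G_1)\cup V(G_2)$ with edges $E(G_1)\cup E(G_2)$ together with all $\{x,y\}$, $x\in V(G_1)$, $y\in V(G_2)$. A simplicial complex $\Delta$ is vertex decomposable if it is a simplex, the empty complex $\{\emptyset\}$, the void complex, or has a vertex $x$ with $\mathrm{lk}_\Delta(x)$ and $\mathrm{del}_\Delta(x)$ vertex decomposable and every facet of $\mathrm{del}_\Delta(x)$ a facet of $\Delta$. -}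

module Defs where

open import Level using (Level; 0ℓ) renaming (suc to lsuc)
open import Data.Nat using (ℕ)
open import Data.Bool using (Bool; true; false; T)
open import Data.Fin using (Fin; splitAt)
open import Data.Fin.Subset using (Subset; _∈_; _∉_; _⊆_; ∣_∣; ∁; ⁅_⁆; _∪_; ⊥)
open import Data.Sum using (_⊎_; inj₁; inj₂)
open import Data.Product using (Σ; _×_; _,_; ∃)
open import Data.Empty renaming (⊥ to Empty)
open import Relation.Nullary using (¬_)
open import Relation.Binary.PropositionalEquality using (_≡_; refl)

record SimpleGraph (n : ℕ) : Set where
  field
    adj     : Fin n → Fin n → Bool
    symm    : ∀ u v → adj u v ≡ adj v u
    irrefl  : ∀ v → adj v v ≡ false
open SimpleGraph public

-- Join G₁ * G₂ on Fin (n₁ + n₂): the first n₁ vertices are (a copy of)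
-- V(G₁), the remaining n₂ are V(G₂) (so the vertex sets are disjoint).
joinAdj' : ∀ {n₁ n₂} → SimpleGraph n₁ → SimpleGraph n₂ →
           Fin n₁ ⊎ Fin n₂ → Fin n₁ ⊎ Fin n₂ → Bool
joinAdj' G₁ G₂ (inj₁ a) (inj₁ b) = adj G₁ a b
joinAdj' G₁ G₂ (inj₁ a) (inj₂ b) = true
joinAdj' G₁ G₂ (inj₂ a) (inj₁ b) = true
joinAdj' G₁ G₂ (inj₂ a) (inj₂ b) = adj G₂ a b

joinAdj'-symm : ∀ {n₁ n₂} (G₁ : SimpleGraph n₁) (G₂ : SimpleGraph n₂) x y →
                joinAdj' G₁ G₂ x y ≡ joinAdj' G₁ G₂ y x
joinAdj'-symm G₁ G₂ (inj₁ a) (inj₁ b) = symm G₁ a b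
joinAdj'-symm G₁ G₂ (inj₁ a) (inj₂ b) = refl
joinAdj'-symm G₁ G₂ (inj₂ a) (inj₁ b) = refl
joinAdj'-symm G₁ G₂ (inj₂ a) (inj₂ b) = symm G₂ a b

joinAdj'-irrefl : ∀ {n₁ n₂} (G₁ : SimpleGraph n₁) (G₂ : SimpleGraph n₂) x →
                  joinAdj' G₁ G₂ x x ≡ false
joinAdj'-irrefl G₁ G₂ (inj₁ a) = irrefl G₁ a
joinAdj'-irrefl G₁ G₂ (inj₂ a) = irrefl G₂ a

_*ᴳ_ : ∀ {n₁ n₂} → SimpleGraph n₁ → SimpleGraph n₂ → SimpleGraph (n₁ Data.Nat.+ n₂)
_*ᴳ_ {n₁} G₁ G₂ = record
  { adj    = λ u v → joinAdj' G₁ G₂ (splitAt n₁ u) (splitAt n₁ v)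
  ; symm   = λ u v → joinAdj'-symm G₁ G₂ (splitAt n₁ u) (splitAt n₁ v)
  ; irrefl = λ v → joinAdj'-irrefl G₁ G₂ (splitAt n₁ v)
  }

data Reach {n : ℕ} (H : SimpleGraph n) (W : Subset n) : Fin n → Fin n → Set where
  here : ∀ {u} → u ∈ W → Reach H W u u
  step : ∀ {u v w} → Reach H W u v → T (adj H v w) → w ∈ W → Reach H W u w

-- H[W] is connected (W is required nonempty; a graph with no vertices
-- is not connected).  In the theorem |W| = r ≥ 2 anyway.
InducedConnected : ∀ {n} → SimpleGraph n → Subset n → Set
InducedConnected H W = (∃ λ u → u ∈ W) × (∀ u v → u ∈ W → v ∈ W → Reach H W u v)

Complex : ℕ → Set₁
Complex n = Subset n → Set

-- Σ_r(H): generated by the complements V(H) ∖ W, |W| = r, H[W] connected.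
-- A face is any subset of such a generator (void complex if there is none).
Σᵣ : ∀ {n} → ℕ → SimpleGraph n → Complex n
Σᵣ r H σ = ∃ λ W → (∣ W ∣ ≡ r) × InducedConnected H W × (σ ⊆ ∁ W)

lk : ∀ {n} → Complex n → Fin n → Complex n
lk Δ x σ = (x ∉ σ) × Δ (σ ∪ ⁅ x ⁆)

del : ∀ {n} → Complex n → Fin n → Complex n
del Δ x σ = (x ∉ σ) × Δ σ

IsFacet : ∀ {n} → Complex n → Subset n → Set
IsFacet Δ σ = Δ σ × (∀ τ → Δ τ → σ ⊆ τ → τ ⊆ σ)

-- Δ is a simplex: its faces are exactly the subsets of some F
-- (F = ∅ gives the empty complex {∅}).
IsSimplex : ∀ {n} → Complex n → Set
IsSimplex {n} Δ = ∃ λ (F : Subset n) → ∀ σ → (Δ σ → σ ⊆ F) × (σ ⊆ F → Δ σ)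

IsVoid : ∀ {n} → Complex n → Set
IsVoid Δ = ∀ σ → ¬ Δ σ

data VertexDecomposable {n : ℕ} : Complex n → Set₁ where
  simplex : ∀ {Δ} → IsSimplex Δ → VertexDecomposable Δ
  void    : ∀ {Δ} → IsVoid Δ → VertexDecomposable Δ
  shed    : ∀ {Δ} (x : Fin n) → Δ ⁅ x ⁆ →
            VertexDecomposable (lk Δ x) →
            VertexDecomposable (del Δ x) →
            (∀ σ → IsFacet (del Δ x) σ → IsFacet Δ σ) →
            VertexDecomposable Δ

-- A set W of r ≥ 2 vertices of G₁ * G₂ meeting both sides is always connected, so Σᵣ(G₁ * G₂)
-- consists of the sets of size ≤ n₁ + n₂ - r missing a vertex on each side, together with the
-- sets containing one side whose trace on the other side is a face of Σᵣ(Gᵢ).  Hence Σᵣ(Gᵢ) is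
-- the link of the opposite side in Σᵣ(G₁ * G₂), and links of vertex-decomposable complexes are
-- vertex decomposable.  Conversely, complexes of this shape are vertex decomposable for all
-- vertex-decomposable P, Q in place of Σᵣ(Gᵢ) and all size bounds d, by induction on the number
-- of vertices: a suitable x ∈ U₁ (a shedding vertex of P, or one with U₁ - x ∈ P) sheds the whole
-- complex, whose link and deletion at x have the same shape on U₁ - x or form a simplex.  The
-- shedding condition is checked in a facet-free exchange form: whenever σ ∪ {x} is a face, so is
-- σ ∪ {y} for some y ∉ σ ∪ {x}.

module Submission where

open import Defs
open import Data.Nat using (ℕ; _≤_)
open import Function.Bundles using (_⇔_)
open import Data.Product using (_×_)
open import Data.Nat using (zero; suc; _+_; _∸_; _<_; z≤n; s≤s; _≤?_)
open import Data.Nat.Properties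
  using (≤-trans; ≤-pred; ≤-reflexive; ≰⇒>; +-comm; +-monoˡ-<; n≮0; +-identityʳ; m≤m+n; m≤n+m)
open import Data.Nat.Properties using (m∸[m∸n]≡n; ∸-monoʳ-≤)
open import Data.Nat.Induction using (<-rec)
open import Data.Bool using (T; true; false)
open import Data.Unit using (tt)
open import Data.Fin using (Fin; zero; suc; _≟_; _↑ˡ_; _↑ʳ_; splitAt)
open import Data.Fin.Properties using (any?; splitAt-↑ˡ; splitAt-↑ʳ; splitAt⁻¹-↑ˡ; splitAt⁻¹-↑ʳ)
open import Data.Fin.Subset
  using (Subset; _∈_; _∉_; _⊆_; _⊈_; ∣_∣; ⁅_⁆; _∪_; _∩_; _─_; _-_; ∁; ⊤; ⊥; inside; outside; Empty)
open import Data.Fin.Subset.Properties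
open import Data.Vec using ([]; _∷_; here; there; _++_)
import Data.Vec as Vec
open import Data.Product using (_,_; proj₁; proj₂; ∃; map₂)
open import Data.Sum using (_⊎_; inj₁; inj₂; [_,_]; [_,_]′)
import Data.Sum as Sum
open import Data.Empty using (⊥-elim)
open import Function using (_∘_; id)
open import Function.Bundles using (mk⇔)
open import Relation.Nullary using (¬_; Dec; yes; no)
import Relation.Nullary.Decidable as Dec
open import Relation.Nullary.Decidable using (_×-dec_; ¬?; decidable-stable)
open import Relation.Unary using (_≐_; Decidable)
open import Relation.Unary.Properties using (≐-sym; ≐-trans)
open import Relation.Binary.PropositionalEquality
  using (_≡_; _≢_; refl; sym; trans; cong; subst; module ≡-Reasoning)

private variable
  m n : ℕ
  x y : Fin n
  p q r s t σ τ U U₁ U₂ : Subset n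
  Δ Γ P Q : Complex n

x∈p─q⁻ : ∀ (p q : Subset n) → x ∈ p ─ q → x ∈ p × x ∉ q
x∈p─q⁻ {x = zero}  (true ∷ p) (false ∷ q) here      = here , λ ()
x∈p─q⁻ {x = suc x} (_ ∷ p)    (_ ∷ q)     (there h) with x∈p─q⁻ p q h
... | x∈p , x∉q = there x∈p , λ { (there x∈q) → x∉q x∈q }

x∈p-y⁻ : x ∈ p - y → x ∈ p × x ≢ y
x∈p-y⁻ {p = p} {y = y} = map₂ x∉⁅y⁆⇒x≢y ∘ x∈p─q⁻ p ⁅ y ⁆

x∉p-x : x ∉ p - x
x∉p-x x∈ = proj₂ (x∈p-y⁻ x∈) refl

x∈p∪⁅y⁆⁻ : x ∈ p ∪ ⁅ y ⁆ → x ∈ p ⊎ x ≡ y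
x∈p∪⁅y⁆⁻ {p = p} {y = y} = Sum.map₂ (x∈⁅y⁆⇒x≡y y) ∘ x∈p∪q⁻ p ⁅ y ⁆

y∈p∪⁅y⁆ : ∀ (p : Subset n) y → y ∈ p ∪ ⁅ y ⁆
y∈p∪⁅y⁆ p y = q⊆p∪q p ⁅ y ⁆ (x∈⁅x⁆ y)

x∉p∪q : x ∉ p → x ∉ q → x ∉ p ∪ q
x∉p∪q {p = p} {q = q} x∉p x∉q = [ x∉p , x∉q ] ∘ x∈p∪q⁻ p q

x∉p∪⁅y⁆ : x ∉ p → x ≢ y → x ∉ p ∪ ⁅ y ⁆
x∉p∪⁅y⁆ x∉p x≢y = x∉p∪q x∉p (x≢y⇒x∉⁅y⁆ x≢y)

x∉p∪⁅y⁆⁻ : x ∉ p ∪ ⁅ y ⁆ → x ∉ p × x ≢ y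
x∉p∪⁅y⁆⁻ {p = p} x∉ = x∉ ∘ p⊆p∪q ⁅ _ ⁆ , λ { refl → x∉ (y∈p∪⁅y⁆ p _) }

∪-least : p ⊆ r → q ⊆ r → p ∪ q ⊆ r
∪-least {p = p} {q = q} p⊆r q⊆r = [ p⊆r , q⊆r ] ∘ x∈p∪q⁻ p q

∪-monoˡ : p ⊆ q → p ∪ r ⊆ q ∪ r
∪-monoˡ {q = q} {r = r} p⊆q = ∪-least (p⊆p∪q r ∘ p⊆q) (q⊆p∪q q r)

∩-monoˡ : p ⊆ q → p ∩ r ⊆ q ∩ r
∩-monoˡ {p = p} {r = r} p⊆q x∈ = x∈p∩q⁺ (p⊆q (p∩q⊆p p r x∈) , p∩q⊆q p r x∈)

∩-monoʳ : q ⊆ r → p ∩ q ⊆ p ∩ r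
∩-monoʳ {q = q} {p = p} q⊆r x∈ = x∈p∩q⁺ (p∩q⊆p p q x∈ , q⊆r (p∩q⊆q p q x∈))

⊈-weaken : q ⊆ r → p ⊈ r → p ⊈ q
⊈-weaken q⊆r p⊈r p⊆q = p⊈r (⊆-trans p⊆q q⊆r)

⁅x⁆⊆p : x ∈ p → ⁅ x ⁆ ⊆ p
⁅x⁆⊆p {x = x} x∈p y∈ rewrite x∈⁅y⁆⇒x≡y x y∈ = x∈p

empty⊆ : Empty p → p ⊆ q
empty⊆ p-empty x∈p = ⊥-elim (p-empty (_ , x∈p))

⊈⇒∃∉ : p ⊈ q → ∃ λ x → x ∈ p × x ∉ q
⊈⇒∃∉ {p = p} {q = q} p⊈q with any? (λ x → x ∈? p ×-dec ¬? (x ∈? q))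
... | yes witness = witness
... | no ∄ = ⊥-elim (p⊈q λ {x} x∈p → decidable-stable (x ∈? q) (λ x∉q → ∄ (x , x∈p , x∉q)))

∣p∪⁅x⁆∣≡1+∣p∣ : ∀ (p : Subset n) → x ∉ p → ∣ p ∪ ⁅ x ⁆ ∣ ≡ suc ∣ p ∣
∣p∪⁅x⁆∣≡1+∣p∣ {x = zero}  (true ∷ p)  x∉p = ⊥-elim (x∉p here)
∣p∪⁅x⁆∣≡1+∣p∣ {x = zero}  (false ∷ p) _   = cong (suc ∘ ∣_∣) (∪-identityʳ p)
∣p∪⁅x⁆∣≡1+∣p∣ {x = suc x} (true ∷ p)  x∉p = cong suc (∣p∪⁅x⁆∣≡1+∣p∣ p (x∉p ∘ there))
∣p∪⁅x⁆∣≡1+∣p∣ {x = suc x} (false ∷ p) x∉p = ∣p∪⁅x⁆∣≡1+∣p∣ p (x∉p ∘ there)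

∃-between : ∀ (p q : Subset n) k → p ⊆ q → ∣ p ∣ ≤ k → k ≤ ∣ q ∣ → ∃ λ w → p ⊆ w × w ⊆ q × ∣ w ∣ ≡ k
∃-between [] [] zero _ _ _ = [] , (λ x∈ → x∈) , (λ x∈ → x∈) , refl
∃-between (true ∷ p) (false ∷ q) k p⊆q _ _ with p⊆q {zero} here
... | ()
∃-between (true ∷ p) (true ∷ q) (suc k) p⊆q (s≤s ∣p∣≤k) (s≤s k≤∣q∣)
  with ∃-between p q k (drop-∷-⊆ p⊆q) ∣p∣≤k k≤∣q∣
... | w , p⊆w , w⊆q , ∣w∣≡k = inside ∷ w , in⊆in p⊆w , in⊆in w⊆q , cong suc ∣w∣≡k
∃-between (false ∷ p) (false ∷ q) k p⊆q ∣p∣≤k k≤∣q∣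
  with ∃-between p q k (drop-∷-⊆ p⊆q) ∣p∣≤k k≤∣q∣
... | w , p⊆w , w⊆q , ∣w∣≡k = outside ∷ w , out⊆ p⊆w , out⊆ w⊆q , ∣w∣≡k
∃-between (false ∷ p) (true ∷ q) k p⊆q ∣p∣≤k k≤1+∣q∣ with k ≤? ∣ q ∣
... | yes k≤∣q∣ with ∃-between p q k (drop-∷-⊆ p⊆q) ∣p∣≤k k≤∣q∣
...   | w , p⊆w , w⊆q , ∣w∣≡k = outside ∷ w , out⊆ p⊆w , out⊆ w⊆q , ∣w∣≡k
∃-between (false ∷ p) (true ∷ q) zero _ _ _ | no k≰∣q∣ = ⊥-elim (k≰∣q∣ z≤n)
∃-between (false ∷ p) (true ∷ q) (suc k) p⊆q ∣p∣≤1+k (s≤s k≤∣q∣) | no 1+k≰∣q∣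
  with ∃-between p q k (drop-∷-⊆ p⊆q)
                 (≤-trans (p⊆q⇒∣p∣≤∣q∣ (drop-∷-⊆ p⊆q)) (≤-pred (≰⇒> 1+k≰∣q∣))) k≤∣q∣
... | w , p⊆w , w⊆q , ∣w∣≡k = inside ∷ w , out⊆ p⊆w , in⊆in w⊆q , cong suc ∣w∣≡k

p-x∪⁅x⁆≡p : x ∈ p → (p - x) ∪ ⁅ x ⁆ ≡ p
p-x∪⁅x⁆≡p {x = x} {p = p} x∈p = ⊆-antisym (∪-least (p─q⊆p p ⁅ x ⁆) (⁅x⁆⊆p x∈p)) p⊆
  where
  p⊆ : p ⊆ (p - x) ∪ ⁅ x ⁆
  p⊆ {y} y∈p with y ≟ x
  ... | yes refl = y∈p∪⁅y⁆ (p - x) x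
  ... | no y≢x   = p⊆p∪q ⁅ x ⁆ (x∈p∧x≢y⇒x∈p-y y∈p y≢x)

p⊆q⇒p⊆q-x : x ∉ p → p ⊆ q → p ⊆ q - x
p⊆q⇒p⊆q-x x∉p p⊆q y∈p = x∈p∧x≢y⇒x∈p-y (p⊆q y∈p) (λ { refl → x∉p y∈p })

p⊆q∪⁅x⁆⇒p-x⊆q : p ⊆ q ∪ ⁅ x ⁆ → p - x ⊆ q
p⊆q∪⁅x⁆⇒p-x⊆q p⊆qx y∈p-x with x∈p-y⁻ y∈p-x
... | y∈p , y≢x = [ id , ⊥-elim ∘ y≢x ] (x∈p∪⁅y⁆⁻ (p⊆qx y∈p))

p-x⊆q⇒p⊆q∪⁅x⁆ : p - x ⊆ q → p ⊆ q ∪ ⁅ x ⁆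
p-x⊆q⇒p⊆q∪⁅x⁆ {x = x} {q = q} p-x⊆q {y} y∈p with y ≟ x
... | yes refl = y∈p∪⁅y⁆ q y
... | no y≢x   = p⊆p∪q ⁅ x ⁆ (p-x⊆q (x∈p∧x≢y⇒x∈p-y y∈p y≢x))

p⊆q∪⁅x⁆⇒p⊆q : x ∉ p → p ⊆ q ∪ ⁅ x ⁆ → p ⊆ q
p⊆q∪⁅x⁆⇒p⊆q x∉p p⊆qx y∈p = [ id , (λ { refl → ⊥-elim (x∉p y∈p) }) ] (x∈p∪⁅y⁆⁻ (p⊆qx y∈p))

p⊆q∪r⇒p⊆q-x∪r : x ∉ p → p ⊆ q ∪ r → p ⊆ (q - x) ∪ r
p⊆q∪r⇒p⊆q-x∪r {p = p} {q = q} {r = r} x∉p p⊆qr y∈p =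
  [ (λ y∈q → p⊆p∪q r (x∈p∧x≢y⇒x∈p-y y∈q (λ { refl → x∉p y∈p }))) , q⊆p∪q (q - _) r ]
    (x∈p∪q⁻ q r (p⊆qr y∈p))

∪-swapʳ : ∀ (p q r : Subset n) → (p ∪ q) ∪ r ≡ (p ∪ r) ∪ q
∪-swapʳ p q r = begin
  (p ∪ q) ∪ r  ≡⟨ ∪-assoc p q r ⟩
  p ∪ (q ∪ r)  ≡⟨ cong (p ∪_) (∪-comm q r) ⟩
  p ∪ (r ∪ q)  ≡⟨ ∪-assoc p r q ⟨
  (p ∪ r) ∪ q  ∎
  where open ≡-Reasoning

p∪⁅y⁆∩q≡p∩q∪⁅y⁆ : ∀ (p : Subset n) → y ∈ q → (p ∪ ⁅ y ⁆) ∩ q ≡ (p ∩ q) ∪ ⁅ y ⁆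
p∪⁅y⁆∩q≡p∩q∪⁅y⁆ {y = y} {q = q} p y∈q = ⊆-antisym to from
  where
  to : (p ∪ ⁅ y ⁆) ∩ q ⊆ (p ∩ q) ∪ ⁅ y ⁆
  to z∈ with x∈p∩q⁻ _ q z∈
  ... | z∈py , z∈q = [ (λ z∈p → p⊆p∪q ⁅ y ⁆ (x∈p∩q⁺ (z∈p , z∈q))) , (λ { refl → y∈p∪⁅y⁆ (p ∩ q) y }) ]
                       (x∈p∪⁅y⁆⁻ z∈py)
  from : (p ∩ q) ∪ ⁅ y ⁆ ⊆ (p ∪ ⁅ y ⁆) ∩ q
  from z∈ = [ ∩-monoˡ (p⊆p∪q ⁅ y ⁆) , (λ { refl → x∈p∩q⁺ (y∈p∪⁅y⁆ p y , y∈q) }) ] (x∈p∪⁅y⁆⁻ z∈)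

p∪⁅y⁆∩q≡p∩q : ∀ (p : Subset n) → y ∉ q → (p ∪ ⁅ y ⁆) ∩ q ≡ p ∩ q
p∪⁅y⁆∩q≡p∩q {y = y} {q = q} p y∉q = ⊆-antisym to (∩-monoˡ (p⊆p∪q ⁅ y ⁆))
  where
  to : (p ∪ ⁅ y ⁆) ∩ q ⊆ p ∩ q
  to z∈ with x∈p∩q⁻ _ q z∈
  ... | z∈py , z∈q = [ (λ z∈p → x∈p∩q⁺ (z∈p , z∈q)) , (λ { refl → ⊥-elim (y∉q z∈q) }) ] (x∈p∪⁅y⁆⁻ z∈py)

p∩q-x≡p∩q : ∀ (p q : Subset n) → x ∉ p → p ∩ (q - x) ≡ p ∩ q
p∩q-x≡p∩q p q x∉p = ⊆-antisym (∩-monoʳ (p─q⊆p q ⁅ _ ⁆)) to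
  where
  to : p ∩ q ⊆ p ∩ (q - _)
  to z∈ with x∈p∩q⁻ p q z∈
  ... | z∈p , z∈q = x∈p∩q⁺ (z∈p , x∈p∧x≢y⇒x∈p-y z∈q (λ { refl → x∉p z∈p }))

Disjoint : Subset n → Subset n → Set
Disjoint p q = ∀ {x} → x ∈ p → x ∉ q

disjoint-∪⁅⁆ : Disjoint p q → y ∉ q → Disjoint (p ∪ ⁅ y ⁆) q
disjoint-∪⁅⁆ p#q y∉q = [ p#q , (λ { refl → y∉q }) ] ∘ x∈p∪⁅y⁆⁻

⁅x⁆#p : x ∉ p → Disjoint ⁅ x ⁆ p
⁅x⁆#p {x = x} x∉p y∈⁅x⁆ rewrite x∈⁅y⁆⇒x≡y x y∈⁅x⁆ = x∉p

-- Simplicial complexes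

DownClosed : Complex n → Set
DownClosed Δ = ∀ {σ τ} → σ ⊆ τ → Δ τ → Δ σ

Shedding : Complex n → Fin n → Set
Shedding Δ x = ∀ σ → IsFacet (del Δ x) σ → IsFacet Δ σ

-- Equivalent to Shedding for down-closed decidable complexes, but mentions no facets, which
-- makes it easy to transport to links and join complexes.
Exchange : Complex n → Fin n → Set
Exchange Δ x = ∀ {σ} → x ∉ σ → Δ (σ ∪ ⁅ x ⁆) → ∃ λ y → y ∉ σ × y ≢ x × Δ (σ ∪ ⁅ y ⁆)

lkSet : Complex n → Subset n → Complex n
lkSet Δ τ ρ = Disjoint ρ τ × Δ (ρ ∪ τ)

lk-resp-≐ : Δ ≐ Γ → lk Δ x ≐ lk Γ x
lk-resp-≐ (Δ⊆Γ , Γ⊆Δ) = map₂ Δ⊆Γ , map₂ Γ⊆Δ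

del-resp-≐ : Δ ≐ Γ → del Δ x ≐ del Γ x
del-resp-≐ (Δ⊆Γ , Γ⊆Δ) = map₂ Δ⊆Γ , map₂ Γ⊆Δ

isFacet-resp-≐ : Δ ≐ Γ → ∀ {σ} → IsFacet Δ σ → IsFacet Γ σ
isFacet-resp-≐ (Δ⊆Γ , Γ⊆Δ) (σ∈Δ , maximal) = Δ⊆Γ σ∈Δ , λ τ τ∈Γ → maximal τ (Γ⊆Δ τ∈Γ)

vd-resp-≐ : Δ ≐ Γ → VertexDecomposable Δ → VertexDecomposable Γ
vd-resp-≐ (Δ⊆Γ , Γ⊆Δ) (simplex (F , faces)) =
  simplex (F , λ σ → proj₁ (faces σ) ∘ Γ⊆Δ , Δ⊆Γ ∘ proj₂ (faces σ))
vd-resp-≐ (_ , Γ⊆Δ) (void v) = void (λ σ → v σ ∘ Γ⊆Δ)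
vd-resp-≐ Δ≐Γ@(Δ⊆Γ , _) (shed x x∈Δ lk-vd del-vd shedding) =
  shed x (Δ⊆Γ x∈Δ) (vd-resp-≐ (lk-resp-≐ Δ≐Γ) lk-vd) (vd-resp-≐ (del-resp-≐ Δ≐Γ) del-vd)
    (λ σ → isFacet-resp-≐ Δ≐Γ ∘ shedding σ ∘ isFacet-resp-≐ (≐-sym (del-resp-≐ Δ≐Γ)))

vd⇒decidable : VertexDecomposable Δ → Decidable Δ
vd⇒decidable (simplex (F , faces)) σ with σ ⊆? F
... | yes σ⊆F = yes (proj₂ (faces σ) σ⊆F)
... | no σ⊈F  = no (σ⊈F ∘ proj₁ (faces σ))
vd⇒decidable (void v) σ = no (v σ)
vd⇒decidable {Δ = Δ} (shed x _ lk-vd del-vd _) σ with x ∈? σ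
... | yes x∈σ = Dec.map′ (subst Δ (p-x∪⁅x⁆≡p x∈σ) ∘ proj₂)
                         (λ σ∈Δ → x∉p-x , subst Δ (sym (p-x∪⁅x⁆≡p x∈σ)) σ∈Δ)
                         (vd⇒decidable lk-vd (σ - x))
... | no x∉σ  = Dec.map′ proj₂ (x∉σ ,_) (vd⇒decidable del-vd σ)

exchange⇒shedding : DownClosed Δ → Exchange Δ x → Shedding Δ x
exchange⇒shedding {Δ = Δ} {x = x} closed exchange σ ((x∉σ , σ∈Δ) , maximal) = σ∈Δ , σ-maximal
  where
  σ-maximal : ∀ τ → Δ τ → σ ⊆ τ → τ ⊆ σ
  σ-maximal τ τ∈Δ σ⊆τ with x ∈? τ
  ... | no x∉τ = maximal τ (x∉τ , τ∈Δ) σ⊆τ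
  ... | yes x∈τ with exchange x∉σ (closed (∪-least σ⊆τ (⁅x⁆⊆p x∈τ)) τ∈Δ)
  ...   | y , y∉σ , y≢x , σy∈Δ =
    ⊥-elim (y∉σ (maximal (σ ∪ ⁅ y ⁆) (x∉p∪⁅y⁆ x∉σ (y≢x ∘ sym) , σy∈Δ) (p⊆p∪q ⁅ y ⁆) (y∈p∪⁅y⁆ σ y)))

shedding⇒exchange : DownClosed Δ → Decidable Δ → Shedding Δ x → Exchange Δ x
shedding⇒exchange {Δ = Δ} {x = x} closed Δ? shedding {σ} x∉σ σx∈Δ
  with any? (λ y → ¬? (y ∈? σ) ×-dec ¬? (y ≟ x) ×-dec Δ? (σ ∪ ⁅ y ⁆))
... | yes witness = witness
... | no ∄ = ⊥-elim (x∉σ (proj₂ (shedding σ σ-facet) (σ ∪ ⁅ x ⁆) σx∈Δ (p⊆p∪q ⁅ x ⁆) (y∈p∪⁅y⁆ σ x)))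
  where
  σ-maximal : ∀ τ → del Δ x τ → σ ⊆ τ → τ ⊆ σ
  σ-maximal τ (x∉τ , τ∈Δ) σ⊆τ {y} y∈τ = decidable-stable (y ∈? σ) λ y∉σ →
    ∄ (y , y∉σ , (λ { refl → x∉τ y∈τ }) , closed (∪-least σ⊆τ (⁅x⁆⊆p y∈τ)) τ∈Δ)
  σ-facet : IsFacet (del Δ x) σ
  σ-facet = (x∉σ , closed (p⊆p∪q ⁅ x ⁆) σx∈Δ) , σ-maximal

lk-downClosed : DownClosed Δ → DownClosed (lk Δ x)
lk-downClosed closed σ⊆τ (x∉τ , τx∈Δ) = x∉τ ∘ σ⊆τ , closed (∪-monoˡ σ⊆τ) τx∈Δ

del-downClosed : DownClosed Δ → DownClosed (del Δ x)
del-downClosed closed σ⊆τ (x∉τ , τ∈Δ) = x∉τ ∘ σ⊆τ , closed σ⊆τ τ∈Δ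

lkSet-downClosed : DownClosed Δ → ∀ τ → DownClosed (lkSet Δ τ)
lkSet-downClosed closed τ σ⊆ρ (ρ#τ , ρτ∈Δ) = ρ#τ ∘ σ⊆ρ , closed (∪-monoˡ σ⊆ρ) ρτ∈Δ

lkSet-exchange : ∀ {τ} → x ∉ τ → Exchange Δ x → Exchange (lkSet Δ τ) x
lkSet-exchange {x = x} {Δ = Δ} {τ = τ} x∉τ exchange {σ} x∉σ (σx#τ , σxτ∈Δ)
  with exchange (x∉p∪q x∉σ x∉τ) (subst Δ (∪-swapʳ σ ⁅ x ⁆ τ) σxτ∈Δ)
... | y , y∉στ , y≢x , στy∈Δ =
  y , y∉στ ∘ p⊆p∪q τ , y≢x ,
  disjoint-∪⁅⁆ (σx#τ ∘ p⊆p∪q ⁅ x ⁆) (y∉στ ∘ q⊆p∪q σ τ) , subst Δ (∪-swapʳ σ τ ⁅ y ⁆) στy∈Δ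

lkSet-lk : ∀ {τ} → x ∈ τ → lkSet (lk Δ x) (τ - x) ≐ lkSet Δ τ
lkSet-lk {x = x} {Δ = Δ} {τ = τ} x∈τ = to , from
  where
  merge : ∀ ρ → (ρ ∪ (τ - x)) ∪ ⁅ x ⁆ ≡ ρ ∪ τ
  merge ρ = trans (∪-assoc ρ (τ - x) ⁅ x ⁆) (cong (ρ ∪_) (p-x∪⁅x⁆≡p x∈τ))
  to : ∀ {ρ} → lkSet (lk Δ x) (τ - x) ρ → lkSet Δ τ ρ
  to {ρ} (ρ#τ-x , x∉ρτ , ρτ∈Δ) = ρ#τ , subst Δ (merge ρ) ρτ∈Δ
    where
    ρ#τ : Disjoint ρ τ
    ρ#τ {y} y∈ρ y∈τ with y ≟ x
    ... | yes refl = x∉ρτ (p⊆p∪q (τ - x) y∈ρ)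
    ... | no y≢x   = ρ#τ-x y∈ρ (x∈p∧x≢y⇒x∈p-y y∈τ y≢x)
  from : ∀ {ρ} → lkSet Δ τ ρ → lkSet (lk Δ x) (τ - x) ρ
  from {ρ} (ρ#τ , ρτ∈Δ) =
    (λ y∈ρ → ρ#τ y∈ρ ∘ p─q⊆p τ ⁅ x ⁆) , x∉p∪q (λ x∈ρ → ρ#τ x∈ρ x∈τ) x∉p-x , subst Δ (sym (merge ρ)) ρτ∈Δ

lkSet-lk-comm : ∀ {τ} → x ∉ τ → lkSet (lk Δ x) τ ≐ lk (lkSet Δ τ) x
lkSet-lk-comm {x = x} {Δ = Δ} {τ = τ} x∉τ =
  (λ { {ρ} (ρ#τ , x∉ρτ , ρτx∈Δ) →
         x∉ρτ ∘ p⊆p∪q τ , disjoint-∪⁅⁆ ρ#τ x∉τ , subst Δ (∪-swapʳ ρ τ ⁅ x ⁆) ρτx∈Δ }) ,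
  (λ { {ρ} (x∉ρ , ρx#τ , ρxτ∈Δ) →
         ρx#τ ∘ p⊆p∪q ⁅ x ⁆ , x∉p∪q x∉ρ x∉τ , subst Δ (∪-swapʳ ρ ⁅ x ⁆ τ) ρxτ∈Δ })

lkSet-del-comm : ∀ {τ} → x ∉ τ → lkSet (del Δ x) τ ≐ del (lkSet Δ τ) x
lkSet-del-comm {τ = τ} x∉τ =
  (λ { (ρ#τ , x∉ρτ , ρτ∈Δ) → x∉ρτ ∘ p⊆p∪q τ , ρ#τ , ρτ∈Δ }) ,
  (λ { (x∉ρ , ρ#τ , ρτ∈Δ) → ρ#τ , x∉p∪q x∉ρ x∉τ , ρτ∈Δ })

lkSet-del : ∀ {τ} → DownClosed Δ → ¬ Δ (τ ∪ ⁅ x ⁆) → lkSet (del Δ x) τ ≐ lkSet Δ τ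
lkSet-del {x = x} {τ = τ} closed τx∉Δ =
  (λ { (ρ#τ , _ , ρτ∈Δ) → ρ#τ , ρτ∈Δ }) ,
  (λ { {ρ} (ρ#τ , ρτ∈Δ) →
         ρ#τ , (λ x∈ρτ → τx∉Δ (closed (∪-least (q⊆p∪q ρ τ) (⁅x⁆⊆p x∈ρτ)) ρτ∈Δ)) , ρτ∈Δ })

vd⇒vd-lkSet : DownClosed Δ → VertexDecomposable Δ → ∀ τ → VertexDecomposable (lkSet Δ τ)
vd⇒vd-lkSet closed (simplex (F , faces)) τ with τ ⊆? F
... | yes τ⊆F = simplex (F ─ τ , λ ρ →
        (λ (ρ#τ , ρτ⊆F) ρ∈ → x∈p∧x∉q⇒x∈p─q (proj₁ (faces _) ρτ⊆F (p⊆p∪q τ ρ∈)) (ρ#τ ρ∈)) ,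
        (λ ρ⊆F─τ → proj₂ ∘ x∈p─q⁻ F τ ∘ ρ⊆F─τ ,
                   proj₂ (faces _) (∪-least (proj₁ ∘ x∈p─q⁻ F τ ∘ ρ⊆F─τ) τ⊆F)))
... | no τ⊈F = void (λ ρ (_ , ρτ∈Δ) → τ⊈F (proj₁ (faces _) ρτ∈Δ ∘ q⊆p∪q ρ τ))
vd⇒vd-lkSet closed (void v) τ = void (λ ρ → v _ ∘ proj₂)
vd⇒vd-lkSet {Δ = Δ} closed Δ-vd@(shed x _ lk-vd del-vd shedding) τ with x ∈? τ
... | yes x∈τ = vd-resp-≐ (lkSet-lk {Δ = Δ} x∈τ) (vd⇒vd-lkSet (lk-downClosed closed) lk-vd (τ - x))
... | no x∉τ with vd⇒decidable Δ-vd (τ ∪ ⁅ x ⁆)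
...   | no τx∉Δ =
  vd-resp-≐ (lkSet-del {Δ = Δ} closed τx∉Δ) (vd⇒vd-lkSet (del-downClosed closed) del-vd τ)
...   | yes τx∈Δ =
  shed x (⁅x⁆#p x∉τ , subst Δ (∪-comm τ ⁅ x ⁆) τx∈Δ)
    (vd-resp-≐ (lkSet-lk-comm {Δ = Δ} x∉τ) (vd⇒vd-lkSet (lk-downClosed closed) lk-vd τ))
    (vd-resp-≐ (lkSet-del-comm {Δ = Δ} x∉τ) (vd⇒vd-lkSet (del-downClosed closed) del-vd τ))
    (exchange⇒shedding (lkSet-downClosed closed τ)
      (lkSet-exchange {Δ = Δ} x∉τ (shedding⇒exchange closed (vd⇒decidable Δ-vd) shedding)))

lkSet-⁅⁆ : lkSet Δ ⁅ x ⁆ ≐ lk Δ x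
lkSet-⁅⁆ {x = x} =
  (λ (ρ#x , ρx∈Δ) → (λ x∈ρ → ρ#x x∈ρ (x∈⁅x⁆ x)) , ρx∈Δ) ,
  (λ { {ρ} (x∉ρ , ρx∈Δ) → (λ y∈ρ y∈⁅x⁆ → x∉ρ (subst (_∈ ρ) (x∈⁅y⁆⇒x≡y x y∈⁅x⁆) y∈ρ)) , ρx∈Δ })

vd⇒vd-lk : DownClosed Δ → VertexDecomposable Δ → ∀ x → VertexDecomposable (lk Δ x)
vd⇒vd-lk {Δ = Δ} closed Δ-vd x = vd-resp-≐ (lkSet-⁅⁆ {Δ = Δ}) (vd⇒vd-lkSet closed Δ-vd ⁅ x ⁆)

-- Join complexes

-- The shape of Σᵣ r (G₁ *ᴳ G₂) (see Σᵣ-join); P, Q and d are arbitrary so that links and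
-- deletions stay of this shape.
data Admissible (U₁ U₂ : Subset n) (P Q : Complex n) (σ : Subset n) : Set where
  mixed : U₁ ⊈ σ → U₂ ⊈ σ → Admissible U₁ U₂ P Q σ
  left  : U₂ ⊆ σ → U₁ ⊈ σ → P (σ ∩ U₁) → Admissible U₁ U₂ P Q σ
  right : U₁ ⊆ σ → U₂ ⊈ σ → Q (σ ∩ U₂) → Admissible U₁ U₂ P Q σ

JoinComplex : Subset n → Subset n → Complex n → Complex n → ℕ → Complex n
JoinComplex U₁ U₂ P Q d σ = σ ⊆ U₁ ∪ U₂ × ∣ σ ∣ ≤ d × Admissible U₁ U₂ P Q σ

SimplexOn : Subset n → Complex n
SimplexOn U σ = σ ⊆ U

Supported : Subset n → Complex n → Set
Supported U Δ = ∀ {σ} → Δ σ → σ ⊆ U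

record JoinData (U₁ U₂ : Subset n) (P Q : Complex n) : Set₁ where
  field
    disjoint    : Disjoint U₁ U₂
    P-vd        : VertexDecomposable P
    Q-vd        : VertexDecomposable Q
    P-closed    : DownClosed P
    Q-closed    : DownClosed Q
    P-supported : Supported U₁ P
    Q-supported : Supported U₂ Q

admissible-swap : Admissible U₁ U₂ P Q σ → Admissible U₂ U₁ Q P σ
admissible-swap (mixed U₁⊈σ U₂⊈σ)   = mixed U₂⊈σ U₁⊈σ
admissible-swap (left U₂⊆σ U₁⊈σ p)  = right U₂⊆σ U₁⊈σ p
admissible-swap (right U₁⊆σ U₂⊈σ q) = left U₁⊆σ U₂⊈σ q

joinComplex-swap : ∀ {d} → JoinComplex U₁ U₂ P Q d ≐ JoinComplex U₂ U₁ Q P d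
joinComplex-swap {U₁ = U₁} {U₂ = U₂} =
  (λ (σ⊆ , size , adm) → subst (_ ⊆_) (∪-comm U₁ U₂) σ⊆ , size , admissible-swap adm) ,
  (λ (σ⊆ , size , adm) → subst (_ ⊆_) (∪-comm U₂ U₁) σ⊆ , size , admissible-swap adm)

joinData-swap : JoinData U₁ U₂ P Q → JoinData U₂ U₁ Q P
joinData-swap J = record
  { disjoint = λ x∈U₂ x∈U₁ → disjoint x∈U₁ x∈U₂
  ; P-vd = Q-vd ; Q-vd = P-vd ; P-closed = Q-closed ; Q-closed = P-closed
  ; P-supported = Q-supported ; Q-supported = P-supported }
  where open JoinData J

admissible-mono : DownClosed P → DownClosed Q → σ ⊆ τ → Admissible U₁ U₂ P Q τ → Admissible U₁ U₂ P Q σ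
admissible-mono _ _ σ⊆τ (mixed U₁⊈τ U₂⊈τ) = mixed (⊈-weaken σ⊆τ U₁⊈τ) (⊈-weaken σ⊆τ U₂⊈τ)
admissible-mono {σ = σ} {U₂ = U₂} P-closed _ σ⊆τ (left U₂⊆τ U₁⊈τ p) with U₂ ⊆? σ
... | yes U₂⊆σ = left U₂⊆σ (⊈-weaken σ⊆τ U₁⊈τ) (P-closed (∩-monoˡ σ⊆τ) p)
... | no U₂⊈σ  = mixed (⊈-weaken σ⊆τ U₁⊈τ) U₂⊈σ
admissible-mono {σ = σ} {U₁ = U₁} _ Q-closed σ⊆τ (right U₁⊆τ U₂⊈τ q) with U₁ ⊆? σ
... | yes U₁⊆σ = right U₁⊆σ (⊈-weaken σ⊆τ U₂⊈τ) (Q-closed (∩-monoˡ σ⊆τ) q)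
... | no U₁⊈σ  = mixed U₁⊈σ (⊈-weaken σ⊆τ U₂⊈τ)

joinComplex-downClosed : DownClosed P → DownClosed Q → ∀ {d} → DownClosed (JoinComplex U₁ U₂ P Q d)
joinComplex-downClosed P-closed Q-closed σ⊆τ (τ⊆ , size , adm) =
  ⊆-trans σ⊆τ τ⊆ , ≤-trans (p⊆q⇒∣p∣≤∣q∣ σ⊆τ) size , admissible-mono P-closed Q-closed σ⊆τ adm

admissible? : Decidable P → Decidable Q → Decidable (Admissible U₁ U₂ P Q)
admissible? {U₁ = U₁} {U₂ = U₂} P? Q? σ with U₁ ⊆? σ | U₂ ⊆? σ
... | no U₁⊈σ  | no U₂⊈σ  = yes (mixed U₁⊈σ U₂⊈σ)
... | no U₁⊈σ  | yes U₂⊆σ = Dec.map′ (left U₂⊆σ U₁⊈σ) trace (P? (σ ∩ U₁))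
  where
  trace : Admissible U₁ U₂ _ _ σ → _
  trace (mixed _ U₂⊈σ) = ⊥-elim (U₂⊈σ U₂⊆σ)
  trace (left _ _ p)   = p
  trace (right U₁⊆σ _ _) = ⊥-elim (U₁⊈σ U₁⊆σ)
... | yes U₁⊆σ | no U₂⊈σ  = Dec.map′ (right U₁⊆σ U₂⊈σ) trace (Q? (σ ∩ U₂))
  where
  trace : Admissible U₁ U₂ _ _ σ → _
  trace (mixed U₁⊈σ _) = ⊥-elim (U₁⊈σ U₁⊆σ)
  trace (left _ U₁⊈σ _) = ⊥-elim (U₁⊈σ U₁⊆σ)
  trace (right _ _ q)  = q
... | yes U₁⊆σ | yes U₂⊆σ = no λ where
  (mixed U₁⊈σ _)   → U₁⊈σ U₁⊆σ
  (left _ U₁⊈σ _)  → U₁⊈σ U₁⊆σ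
  (right _ U₂⊈σ _) → U₂⊈σ U₂⊆σ

joinComplex? : Decidable P → Decidable Q → ∀ d → Decidable (JoinComplex U₁ U₂ P Q d)
joinComplex? {U₁ = U₁} {U₂ = U₂} P? Q? d σ = σ ⊆? U₁ ∪ U₂ ×-dec ∣ σ ∣ ≤? d ×-dec admissible? P? Q? σ

-- Exchange P x, but only at faces not covering U: this also admits any x with P (U - x),
-- which need not shed P.
record ShedCandidate (U : Subset n) (P : Complex n) (x : Fin n) : Set₁ where
  field
    lk-vd    : VertexDecomposable (lk P x)
    del-vd   : VertexDecomposable (del P x)
    exchange : x ∉ σ → P (σ ∪ ⁅ x ⁆) → U ⊈ σ ∪ ⁅ x ⁆ → ∃ λ y → y ∉ σ × y ≢ x × P (σ ∪ ⁅ y ⁆)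

U-x∈P⇒shedCandidate : DownClosed P → Supported U P → VertexDecomposable P → x ∈ U →
                       P (U - x) → ShedCandidate U P x
U-x∈P⇒shedCandidate {P = P} {U = U} {x = x} closed supported P-vd x∈U U-x∈P = record
  { lk-vd    = vd⇒vd-lk closed P-vd x
  ; del-vd   = simplex (U - x , λ σ →
                 (λ (x∉σ , σ∈P) → p⊆q⇒p⊆q-x x∉σ (supported σ∈P)) ,
                 (λ σ⊆U-x → x∉p-x ∘ σ⊆U-x , closed σ⊆U-x U-x∈P))
  ; exchange = exchange }
  where
  exchange : ∀ {σ} → x ∉ σ → P (σ ∪ ⁅ x ⁆) → U ⊈ σ ∪ ⁅ x ⁆ → ∃ λ y → y ∉ σ × y ≢ x × P (σ ∪ ⁅ y ⁆)
  exchange x∉σ σx∈P U⊈σx with ⊈⇒∃∉ U⊈σx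
  ... | y , y∈U , y∉σx with x∉p∪⁅y⁆⁻ y∉σx
  ...   | y∉σ , y≢x =
    y , y∉σ , y≢x ,
    closed (∪-least (p⊆q⇒p⊆q-x x∉σ (⊆-trans (p⊆p∪q ⁅ x ⁆) (supported σx∈P)))
                    (⁅x⁆⊆p (x∈p∧x≢y⇒x∈p-y y∈U y≢x))) U-x∈P

vd⇒shedCandidate : DownClosed P → Supported U P → VertexDecomposable P → x ∈ U →
                   ∃ λ x′ → x′ ∈ U × ShedCandidate U P x′
vd⇒shedCandidate {U = U} {x = x} closed supported P-vd@(simplex (F , faces)) x∈U with U ⊆? F
... | yes U⊆F =
  x , x∈U ,
  U-x∈P⇒shedCandidate closed supported P-vd x∈U (proj₂ (faces _) (⊆-trans (p─q⊆p U ⁅ x ⁆) U⊆F))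
... | no U⊈F with ⊈⇒∃∉ U⊈F
...   | z , z∈U , z∉F = z , z∈U , record
  { lk-vd    = void (λ σ (_ , σz∈P) → z∉F (proj₁ (faces _) σz∈P (y∈p∪⁅y⁆ σ z)))
  ; del-vd   = vd-resp-≐ ((λ σ∈P → (z∉F ∘ proj₁ (faces _) σ∈P) , σ∈P) , proj₂) P-vd
  ; exchange = λ {σ} _ σz∈P _ → ⊥-elim (z∉F (proj₁ (faces _) σz∈P (y∈p∪⁅y⁆ σ z))) }
vd⇒shedCandidate {x = x} _ _ (void v) x∈U = x , x∈U , record
  { lk-vd    = void (λ σ → v _ ∘ proj₂)
  ; del-vd   = void (λ σ → v σ ∘ proj₂)
  ; exchange = λ _ σx∈P → ⊥-elim (v _ σx∈P) }
vd⇒shedCandidate closed supported P-vd@(shed z z∈P lk-vd del-vd shedding) _ =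
  z , supported z∈P (x∈⁅x⁆ z) , record
  { lk-vd    = lk-vd
  ; del-vd   = del-vd
  ; exchange = λ z∉σ σz∈P _ → shedding⇒exchange closed (vd⇒decidable P-vd) shedding z∉σ σz∈P }

VDBelow : ℕ → ℕ → Set₁
VDBelow n m = ∀ {U₁ U₂ : Subset n} {P Q} → ∣ U₁ ∣ + ∣ U₂ ∣ < m → JoinData U₁ U₂ P Q →
                ∀ d → VertexDecomposable (JoinComplex U₁ U₂ P Q d)

-- good settles the exchange at a face σ ∪ ⁅ x ⁆ of shape right that misses only y ∈ U₂: then
-- σ ∪ ⁅ y ⁆ has shape left by P (U₁ - x), or such a face cannot exist since Q (U₂ - y) fails.
module ShedAt {U₁ U₂ : Subset n} {P Q : Complex n} (J : JoinData U₁ U₂ P Q)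
              (ih : VDBelow n (∣ U₁ ∣ + ∣ U₂ ∣)) (x∈U₁ : x ∈ U₁) (c : ShedCandidate U₁ P x)
              (good : P (U₁ - x) ⊎ (∀ {y} → y ∈ U₂ → ¬ Q (U₂ - y))) where
  open JoinData J
  open ShedCandidate c

  Φ : ℕ → Complex n
  Φ = JoinComplex U₁ U₂ P Q

  x∉U₂ : x ∉ U₂
  x∉U₂ = disjoint x∈U₁

  smaller : ∣ U₁ - x ∣ + ∣ U₂ ∣ < ∣ U₁ ∣ + ∣ U₂ ∣
  smaller = +-monoˡ-< ∣ U₂ ∣ (x∈p⇒∣p-x∣<∣p∣ x∈U₁)

  Φ-closed : ∀ {d} → DownClosed (Φ d)
  Φ-closed = joinComplex-downClosed P-closed Q-closed

  Φ? : ∀ d → Decidable (Φ d)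
  Φ? = joinComplex? (vd⇒decidable P-vd) (vd⇒decidable Q-vd)

  x∉σ⇒U₁⊈σ : x ∉ σ → U₁ ⊈ σ
  x∉σ⇒U₁⊈σ x∉σ U₁⊆σ = x∉σ (U₁⊆σ x∈U₁)

  lk-data : JoinData (U₁ - x) U₂ (lk P x) Q
  lk-data = record
    { disjoint = disjoint ∘ p─q⊆p U₁ ⁅ x ⁆ ; P-vd = lk-vd ; Q-vd = Q-vd
    ; P-closed = lk-downClosed P-closed ; Q-closed = Q-closed
    ; P-supported = λ (x∉σ , σx∈P) → p⊆q⇒p⊆q-x x∉σ (P-supported σx∈P ∘ p⊆p∪q ⁅ x ⁆)
    ; Q-supported = Q-supported }

  lk-trace : x ∉ σ → (σ ∪ ⁅ x ⁆) ∩ U₁ ≡ (σ ∩ (U₁ - x)) ∪ ⁅ x ⁆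
  lk-trace {σ = σ} x∉σ = trans (p∪⁅y⁆∩q≡p∩q∪⁅y⁆ σ x∈U₁) (cong (_∪ ⁅ x ⁆) (sym (p∩q-x≡p∩q σ U₁ x∉σ)))

  admissible-lk⁺ : x ∉ σ → Admissible (U₁ - x) U₂ (lk P x) Q σ → Admissible U₁ U₂ P Q (σ ∪ ⁅ x ⁆)
  admissible-lk⁺ _ (mixed U₁-x⊈σ U₂⊈σ) =
    mixed (U₁-x⊈σ ∘ p⊆q∪⁅x⁆⇒p-x⊆q) (U₂⊈σ ∘ p⊆q∪⁅x⁆⇒p⊆q x∉U₂)
  admissible-lk⁺ x∉σ (left U₂⊆σ U₁-x⊈σ (_ , p)) =
    left (⊆-trans U₂⊆σ (p⊆p∪q ⁅ x ⁆)) (U₁-x⊈σ ∘ p⊆q∪⁅x⁆⇒p-x⊆q) (subst P (sym (lk-trace x∉σ)) p)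
  admissible-lk⁺ {σ = σ} _ (right U₁-x⊆σ U₂⊈σ q) =
    right (p-x⊆q⇒p⊆q∪⁅x⁆ U₁-x⊆σ) (U₂⊈σ ∘ p⊆q∪⁅x⁆⇒p⊆q x∉U₂) (subst Q (sym (p∪⁅y⁆∩q≡p∩q σ x∉U₂)) q)

  admissible-lk⁻ : x ∉ σ → Admissible U₁ U₂ P Q (σ ∪ ⁅ x ⁆) → Admissible (U₁ - x) U₂ (lk P x) Q σ
  admissible-lk⁻ _ (mixed U₁⊈σx U₂⊈σx) =
    mixed (U₁⊈σx ∘ p-x⊆q⇒p⊆q∪⁅x⁆) (⊈-weaken (p⊆p∪q ⁅ x ⁆) U₂⊈σx)
  admissible-lk⁻ {σ = σ} x∉σ (left U₂⊆σx U₁⊈σx p) =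
    left (p⊆q∪⁅x⁆⇒p⊆q x∉U₂ U₂⊆σx) (U₁⊈σx ∘ p-x⊆q⇒p⊆q∪⁅x⁆)
         (x∉σ ∘ p∩q⊆p σ (U₁ - x) , subst P (lk-trace x∉σ) p)
  admissible-lk⁻ {σ = σ} _ (right U₁⊆σx U₂⊈σx q) =
    right (p⊆q∪⁅x⁆⇒p-x⊆q U₁⊆σx) (⊈-weaken (p⊆p∪q ⁅ x ⁆) U₂⊈σx) (subst Q (p∪⁅y⁆∩q≡p∩q σ x∉U₂) q)

  lk-Φ : ∀ d → JoinComplex (U₁ - x) U₂ (lk P x) Q d ≐ lk (Φ (suc d)) x
  lk-Φ d = to , from
    where
    to : ∀ {σ} → JoinComplex (U₁ - x) U₂ (lk P x) Q d σ → lk (Φ (suc d)) x σ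
    to {σ} (σ⊆ , size , adm) =
      x∉σ ,
      ∪-least (⊆-trans σ⊆ (∪-monoˡ (p─q⊆p U₁ ⁅ x ⁆))) (⁅x⁆⊆p (p⊆p∪q U₂ x∈U₁)) ,
      subst (_≤ suc d) (sym (∣p∪⁅x⁆∣≡1+∣p∣ σ x∉σ)) (s≤s size) ,
      admissible-lk⁺ x∉σ adm
      where
      x∉σ : x ∉ σ
      x∉σ = x∉p∪q x∉p-x x∉U₂ ∘ σ⊆
    from : ∀ {σ} → lk (Φ (suc d)) x σ → JoinComplex (U₁ - x) U₂ (lk P x) Q d σ
    from {σ} (x∉σ , σx⊆ , size , adm) =
      p⊆q∪r⇒p⊆q-x∪r x∉σ (⊆-trans (p⊆p∪q ⁅ x ⁆) σx⊆) ,
      ≤-pred (subst (_≤ suc d) (∣p∪⁅x⁆∣≡1+∣p∣ σ x∉σ) size) ,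
      admissible-lk⁻ x∉σ adm

  del-data : JoinData (U₁ - x) U₂ (del P x) (SimplexOn U₂)
  del-data = record
    { disjoint = disjoint ∘ p─q⊆p U₁ ⁅ x ⁆ ; P-vd = del-vd ; Q-vd = simplex (U₂ , λ _ → id , id)
    ; P-closed = del-downClosed P-closed ; Q-closed = λ σ⊆τ τ⊆U₂ → ⊆-trans σ⊆τ τ⊆U₂
    ; P-supported = λ (x∉σ , σ∈P) → p⊆q⇒p⊆q-x x∉σ (P-supported σ∈P)
    ; Q-supported = id }

  admissible-del⁺ : x ∉ σ → Admissible (U₁ - x) U₂ (del P x) (SimplexOn U₂) σ → Admissible U₁ U₂ P Q σ
  admissible-del⁺ x∉σ (mixed _ U₂⊈σ)      = mixed (x∉σ⇒U₁⊈σ x∉σ) U₂⊈σ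
  admissible-del⁺ {σ = σ} x∉σ (left U₂⊆σ _ (_ , p)) =
    left U₂⊆σ (x∉σ⇒U₁⊈σ x∉σ) (subst P (p∩q-x≡p∩q σ U₁ x∉σ) p)
  admissible-del⁺ x∉σ (right _ U₂⊈σ _)    = mixed (x∉σ⇒U₁⊈σ x∉σ) U₂⊈σ

  admissible-del⁻ : ∀ {d} → ¬ Φ d ((U₁ - x) ∪ U₂) → x ∉ σ → Φ d σ →
                    Admissible (U₁ - x) U₂ (del P x) (SimplexOn U₂) σ
  admissible-del⁻ {σ = σ} _ _ (_ , _ , mixed _ U₂⊈σ) with U₁ - x ⊆? σ
  ... | yes U₁-x⊆σ = right U₁-x⊆σ U₂⊈σ (p∩q⊆q σ U₂)
  ... | no U₁-x⊈σ  = mixed U₁-x⊈σ U₂⊈σ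
  admissible-del⁻ {σ = σ} top∉Φ x∉σ σ∈Φ@(_ , _ , left U₂⊆σ _ p) with U₁ - x ⊆? σ
  ... | yes U₁-x⊆σ = ⊥-elim (top∉Φ (Φ-closed (∪-least U₁-x⊆σ U₂⊆σ) σ∈Φ))
  ... | no U₁-x⊈σ  = left U₂⊆σ U₁-x⊈σ (x∉σ ∘ p∩q⊆p σ (U₁ - x) , subst P (sym (p∩q-x≡p∩q σ U₁ x∉σ)) p)
  admissible-del⁻ _ x∉σ (_ , _ , right U₁⊆σ _ _) = ⊥-elim (x∉σ (U₁⊆σ x∈U₁))

  del-Φ : ∀ d → ¬ Φ d ((U₁ - x) ∪ U₂) → JoinComplex (U₁ - x) U₂ (del P x) (SimplexOn U₂) d ≐ del (Φ d) x
  del-Φ d top∉Φ =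
    (λ (σ⊆ , size , adm) → let x∉σ = x∉p∪q x∉p-x x∉U₂ ∘ σ⊆ in
       x∉σ , ⊆-trans σ⊆ (∪-monoˡ (p─q⊆p U₁ ⁅ x ⁆)) , size , admissible-del⁺ x∉σ adm) ,
    (λ (x∉σ , σ∈Φ@(σ⊆ , size , _)) → p⊆q∪r⇒p⊆q-x∪r x∉σ σ⊆ , size , admissible-del⁻ top∉Φ x∉σ σ∈Φ)

  del-Φ-vd : ∀ d → VertexDecomposable (del (Φ d) x)
  del-Φ-vd d with Φ? d ((U₁ - x) ∪ U₂)
  ... | yes top∈Φ = simplex ((U₁ - x) ∪ U₂ , λ σ →
          (λ (x∉σ , σ⊆ , _) → p⊆q∪r⇒p⊆q-x∪r x∉σ σ⊆) ,
          (λ σ⊆top → x∉p∪q x∉p-x x∉U₂ ∘ σ⊆top , Φ-closed σ⊆top top∈Φ))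
  ... | no top∉Φ = vd-resp-≐ (del-Φ d top∉Φ) (ih smaller del-data d)

  Exchanged : Subset n → Set
  Exchanged σ = ∃ λ y → y ∉ σ × y ≢ x × y ∈ U₁ ∪ U₂ × Admissible U₁ U₂ P Q (σ ∪ ⁅ y ⁆)

  exchange-admissible : x ∉ σ → Admissible U₁ U₂ P Q (σ ∪ ⁅ x ⁆) → Exchanged σ
  exchange-admissible {σ = σ} x∉σ (mixed U₁⊈σx U₂⊈σx) with ⊈⇒∃∉ U₁⊈σx
  ... | y , y∈U₁ , y∉σx with x∉p∪⁅y⁆⁻ y∉σx
  ...   | y∉σ , y≢x =
    y , y∉σ , y≢x , p⊆p∪q U₂ y∈U₁ ,
    mixed (x∉σ⇒U₁⊈σ (x∉p∪⁅y⁆ x∉σ (y≢x ∘ sym)))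
          (λ U₂⊆σy → U₂⊈σx (⊆-trans (p⊆q∪⁅x⁆⇒p⊆q (disjoint y∈U₁) U₂⊆σy) (p⊆p∪q ⁅ x ⁆)))
  exchange-admissible {σ = σ} x∉σ (left U₂⊆σx U₁⊈σx p)
    with exchange (x∉σ ∘ p∩q⊆p σ U₁) (subst P (p∪⁅y⁆∩q≡p∩q∪⁅y⁆ σ x∈U₁) p)
                  (⊈-weaken (∪-monoˡ (p∩q⊆p σ U₁)) U₁⊈σx)
  ... | y , y∉σ∩U₁ , y≢x , py =
    y , y∉σ , y≢x , p⊆p∪q U₂ y∈U₁ ,
    left (⊆-trans (p⊆q∪⁅x⁆⇒p⊆q x∉U₂ U₂⊆σx) (p⊆p∪q ⁅ y ⁆)) (x∉σ⇒U₁⊈σ (x∉p∪⁅y⁆ x∉σ (y≢x ∘ sym)))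
         (subst P (sym (p∪⁅y⁆∩q≡p∩q∪⁅y⁆ σ y∈U₁)) py)
    where
    y∈U₁ : y ∈ U₁
    y∈U₁ = P-supported py (y∈p∪⁅y⁆ (σ ∩ U₁) y)
    y∉σ : y ∉ σ
    y∉σ y∈σ = y∉σ∩U₁ (x∈p∩q⁺ (y∈σ , y∈U₁))
  exchange-admissible {σ = σ} x∉σ (right U₁⊆σx U₂⊈σx q) with ⊈⇒∃∉ U₂⊈σx
  ... | y , y∈U₂ , y∉σx with x∉p∪⁅y⁆⁻ y∉σx
  ...   | y∉σ , y≢x = y , y∉σ , y≢x , q⊆p∪q U₁ U₂ y∈U₂ , adm (U₂ ⊆? σ ∪ ⁅ y ⁆) good
    where
    x∉σy : x ∉ σ ∪ ⁅ y ⁆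
    x∉σy = x∉p∪⁅y⁆ x∉σ (y≢x ∘ sym)
    adm : Dec (U₂ ⊆ σ ∪ ⁅ y ⁆) → P (U₁ - x) ⊎ (∀ {y} → y ∈ U₂ → ¬ Q (U₂ - y)) →
          Admissible U₁ U₂ P Q (σ ∪ ⁅ y ⁆)
    adm (no U₂⊈σy) _ = mixed (x∉σ⇒U₁⊈σ x∉σy) U₂⊈σy
    adm (yes U₂⊆σy) (inj₁ U₁-x∈P) =
      left U₂⊆σy (x∉σ⇒U₁⊈σ x∉σy) (P-closed (p⊆q⇒p⊆q-x (x∉σy ∘ p∩q⊆p _ U₁) (p∩q⊆q _ U₁)) U₁-x∈P)
    adm (yes U₂⊆σy) (inj₂ U₂-y∉Q) = ⊥-elim (U₂-y∉Q y∈U₂ (Q-closed U₂-y⊆ q))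
      where
      U₂-y⊆ : U₂ - y ⊆ (σ ∪ ⁅ x ⁆) ∩ U₂
      U₂-y⊆ z∈ = x∈p∩q⁺ (p⊆p∪q ⁅ x ⁆ (p⊆q∪⁅x⁆⇒p-x⊆q U₂⊆σy z∈) , p─q⊆p U₂ ⁅ y ⁆ z∈)

  exchange-Φ : ∀ d → Exchange (Φ d) x
  exchange-Φ d {σ} x∉σ (σx⊆ , size , adm) with exchange-admissible x∉σ adm
  ... | y , y∉σ , y≢x , y∈U , adm′ =
    y , y∉σ , y≢x ,
    (∪-least (⊆-trans (p⊆p∪q ⁅ x ⁆) σx⊆) (⁅x⁆⊆p y∈U) ,
     subst (_≤ d) (trans (∣p∪⁅x⁆∣≡1+∣p∣ σ x∉σ) (sym (∣p∪⁅x⁆∣≡1+∣p∣ σ y∉σ))) size ,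
     adm′)

  vd-without-x : ∀ d → ¬ Φ d ⁅ x ⁆ → VertexDecomposable (Φ d)
  vd-without-x d x∉Φ =
    vd-resp-≐ (proj₂ , λ σ∈Φ → (λ x∈σ → x∉Φ (Φ-closed (⁅x⁆⊆p x∈σ) σ∈Φ)) , σ∈Φ) (del-Φ-vd d)

  Φ-vd : ∀ d → VertexDecomposable (Φ d)
  Φ-vd zero = vd-without-x zero (λ (_ , size , _) → n≮0 (subst (_≤ 0) (∣⁅x⁆∣≡1 x) size))
  Φ-vd (suc d) with Φ? (suc d) ⁅ x ⁆
  ... | no x∉Φ  = vd-without-x (suc d) x∉Φ
  ... | yes x∈Φ = shed x x∈Φ (vd-resp-≐ (lk-Φ d) (ih smaller lk-data d)) (del-Φ-vd (suc d))
                    (exchange⇒shedding Φ-closed (exchange-Φ (suc d)))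

∃U-x∈P? : ∀ (U : Subset n) → Decidable P → Dec (∃ λ x → x ∈ U × P (U - x))
∃U-x∈P? U P? = any? (λ x → x ∈? U ×-dec P? (U - x))

module _ {U₁ U₂ : Subset n} {P Q : Complex n} (J : JoinData U₁ U₂ P Q)
         (ih : VDBelow n (∣ U₁ ∣ + ∣ U₂ ∣)) where
  open JoinData J

  private
    via₁ : x ∈ U₁ → ShedCandidate U₁ P x → P (U₁ - x) ⊎ (∀ {y} → y ∈ U₂ → ¬ Q (U₂ - y)) →
           ∀ d → VertexDecomposable (JoinComplex U₁ U₂ P Q d)
    via₁ = ShedAt.Φ-vd J ih

    via₂ : x ∈ U₂ → ShedCandidate U₂ Q x → Q (U₂ - x) ⊎ (∀ {y} → y ∈ U₁ → ¬ P (U₁ - y)) →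
           ∀ d → VertexDecomposable (JoinComplex U₁ U₂ P Q d)
    via₂ x∈U₂ c good d =
      vd-resp-≐ (joinComplex-swap {U₁ = U₂} {U₂ = U₁})
        (ShedAt.Φ-vd (joinData-swap J) (subst (VDBelow n) (+-comm ∣ U₁ ∣ ∣ U₂ ∣) ih) x∈U₂ c good d)

  joinComplex-vd-step : ∀ d → VertexDecomposable (JoinComplex U₁ U₂ P Q d)
  joinComplex-vd-step
    with ∃U-x∈P? U₁ (vd⇒decidable P-vd) | ∃U-x∈P? U₂ (vd⇒decidable Q-vd)
       | nonempty? U₁ | nonempty? U₂
  ... | yes (x , x∈U₁ , U₁-x∈P) | _ | _ | _ =
    via₁ x∈U₁ (U-x∈P⇒shedCandidate P-closed P-supported P-vd x∈U₁ U₁-x∈P) (inj₁ U₁-x∈P)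
  ... | no _ | yes (y , y∈U₂ , U₂-y∈Q) | _ | _ =
    via₂ y∈U₂ (U-x∈P⇒shedCandidate Q-closed Q-supported Q-vd y∈U₂ U₂-y∈Q) (inj₁ U₂-y∈Q)
  ... | no _ | no ∄y | yes (_ , x∈U₁) | _ =
    let (_ , x′∈U₁ , c) = vd⇒shedCandidate P-closed P-supported P-vd x∈U₁
    in via₁ x′∈U₁ c (inj₂ λ y∈U₂ U₂-y∈Q → ∄y (_ , y∈U₂ , U₂-y∈Q))
  ... | no ∄x | no _ | no _ | yes (_ , y∈U₂) =
    let (_ , y′∈U₂ , c) = vd⇒shedCandidate Q-closed Q-supported Q-vd y∈U₂
    in via₂ y′∈U₂ c (inj₂ λ x∈U₁ U₁-x∈P → ∄x (_ , x∈U₁ , U₁-x∈P))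
  ... | no _ | no _ | no U₁-empty | no U₂-empty = λ _ → void λ where
    _ (_ , _ , mixed U₁⊈σ _)   → U₁⊈σ (empty⊆ U₁-empty)
    _ (_ , _ , left _ U₁⊈σ _)  → U₁⊈σ (empty⊆ U₁-empty)
    _ (_ , _ , right _ U₂⊈σ _) → U₂⊈σ (empty⊆ U₂-empty)

joinComplex-vd : ∀ {U₁ U₂ : Subset n} {P Q} → JoinData U₁ U₂ P Q →
                 ∀ d → VertexDecomposable (JoinComplex U₁ U₂ P Q d)
joinComplex-vd {n = n} J = <-rec VDAt induction-step _ refl J
  where
  VDAt : ℕ → Set₁
  VDAt m = ∀ {U₁ U₂ : Subset n} {P Q} → ∣ U₁ ∣ + ∣ U₂ ∣ ≡ m → JoinData U₁ U₂ P Q →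
           ∀ d → VertexDecomposable (JoinComplex U₁ U₂ P Q d)
  induction-step : ∀ m → (∀ {k} → k < m → VDAt k) → VDAt m
  induction-step _ rec refl J = joinComplex-vd-step J (λ smaller J′ → rec smaller refl J′)

-- Copies along an embedding of vertex sets

record Embedding (m n : ℕ) : Set where
  field
    ι           : Fin m → Fin n
    image       : Subset m → Subset n
    ι∈image⁺    : ∀ {x s} → x ∈ s → ι x ∈ image s
    ι∈image⁻    : ∀ {x s} → ι x ∈ image s → x ∈ s
    image⊆range : ∀ {y s} → y ∈ image s → ∃ λ x → y ≡ ι x
    ⊆image      : ∀ {τ s} → τ ⊆ image s → ∃ λ t → τ ≡ image t
    ∣image∣     : ∀ s → ∣ image s ∣ ≡ ∣ s ∣

module _ {m n : ℕ} (E : Embedding m n) where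
  open Embedding E

  image-mono : s ⊆ t → image s ⊆ image t
  image-mono s⊆t y∈ with image⊆range y∈
  ... | _ , refl = ι∈image⁺ (s⊆t (ι∈image⁻ y∈))

  image-reflects : image s ⊆ image t → s ⊆ t
  image-reflects s⊆t = ι∈image⁻ ∘ s⊆t ∘ ι∈image⁺

  image-injective : image s ≡ image t → s ≡ t
  image-injective eq =
    ⊆-antisym (image-reflects (⊆-reflexive eq)) (image-reflects (⊆-reflexive (sym eq)))

  ι-injective : ∀ {i j} → ι i ≡ ι j → i ≡ j
  ι-injective {i} eq = sym (x∈⁅y⁆⇒x≡y i (ι∈image⁻ (subst (_∈ image ⁅ i ⁆) eq (ι∈image⁺ (x∈⁅x⁆ i)))))

  image-∪⁅⁆ : ∀ s x → image (s ∪ ⁅ x ⁆) ≡ image s ∪ ⁅ ι x ⁆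
  image-∪⁅⁆ s x = ⊆-antisym to (∪-least (image-mono (p⊆p∪q ⁅ x ⁆)) (⁅x⁆⊆p (ι∈image⁺ (y∈p∪⁅y⁆ s x))))
    where
    to : image (s ∪ ⁅ x ⁆) ⊆ image s ∪ ⁅ ι x ⁆
    to y∈ with image⊆range y∈
    ... | _ , refl = [ p⊆p∪q ⁅ ι x ⁆ ∘ ι∈image⁺ , (λ { refl → y∈p∪⁅y⁆ (image s) (ι x) }) ]
                       (x∈p∪⁅y⁆⁻ (ι∈image⁻ y∈))

  image-⁅⁆ : ∀ x → image ⁅ x ⁆ ≡ ⁅ ι x ⁆
  image-⁅⁆ x = ⊆-antisym to (⁅x⁆⊆p (ι∈image⁺ (x∈⁅x⁆ x)))
    where
    to : image ⁅ x ⁆ ⊆ ⁅ ι x ⁆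
    to y∈ with image⊆range y∈
    ... | z , refl rewrite x∈⁅y⁆⇒x≡y x (ι∈image⁻ y∈) = x∈⁅x⁆ (ι x)

  copy : Complex m → Complex n
  copy Δ τ = ∃ λ s → τ ≡ image s × Δ s

  copy-image : copy Δ (image s) → Δ s
  copy-image {Δ = Δ} (_ , eq , t∈Δ) = subst Δ (sym (image-injective eq)) t∈Δ

  copy-downClosed : DownClosed Δ → DownClosed (copy Δ)
  copy-downClosed closed σ⊆τ (s , refl , s∈Δ) with ⊆image σ⊆τ
  ... | t , refl = t , refl , closed (image-reflects σ⊆τ) s∈Δ

  copy-supported : Supported (image ⊤) (copy Δ)
  copy-supported (_ , refl , _) = image-mono ⊆⊤

  isFacet-copy⁺ : IsFacet Δ s → IsFacet (copy Δ) (image s)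
  isFacet-copy⁺ (s∈Δ , maximal) =
    (_ , refl , s∈Δ) , λ { τ (t , refl , t∈Δ) s⊆t → image-mono (maximal t t∈Δ (image-reflects s⊆t)) }

  isFacet-copy⁻ : IsFacet (copy Δ) (image s) → IsFacet Δ s
  isFacet-copy⁻ (s∈copy , maximal) =
    copy-image s∈copy ,
    λ t t∈Δ s⊆t → image-reflects (maximal (image t) (t , refl , t∈Δ) (image-mono s⊆t))

  lk-copy : copy (lk Δ x) ≐ lk (copy Δ) (ι x)
  lk-copy {Δ = Δ} {x = x} = to , from
    where
    to : ∀ {τ} → copy (lk Δ x) τ → lk (copy Δ) (ι x) τ
    to (s , refl , x∉s , sx∈Δ) = x∉s ∘ ι∈image⁻ , s ∪ ⁅ x ⁆ , sym (image-∪⁅⁆ s x) , sx∈Δ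
    from : ∀ {τ} → lk (copy Δ) (ι x) τ → copy (lk Δ x) τ
    from (ιx∉τ , s , eq , s∈Δ) with ⊆image (⊆-trans (p⊆p∪q ⁅ ι x ⁆) (⊆-reflexive eq))
    ... | t , refl =
      t , refl , ιx∉τ ∘ ι∈image⁺ , subst Δ (sym (image-injective (trans (image-∪⁅⁆ t x) eq))) s∈Δ

  del-copy : copy (del Δ x) ≐ del (copy Δ) (ι x)
  del-copy = (λ { (s , refl , x∉s , s∈Δ) → x∉s ∘ ι∈image⁻ , s , refl , s∈Δ })
           , (λ { (ιx∉τ , s , refl , s∈Δ) → s , refl , ιx∉τ ∘ ι∈image⁺ , s∈Δ })

  vd-copy : VertexDecomposable Δ → VertexDecomposable (copy Δ)
  vd-copy {Δ = Δ} (simplex (F , faces)) = simplex (image F , λ τ → to , from)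
    where
    to : ∀ {τ} → copy Δ τ → τ ⊆ image F
    to (s , refl , s∈Δ) = image-mono (proj₁ (faces s) s∈Δ)
    from : ∀ {τ} → τ ⊆ image F → copy Δ τ
    from τ⊆ with ⊆image τ⊆
    ... | t , refl = t , refl , proj₂ (faces t) (image-reflects τ⊆)
  vd-copy (void v) = void (λ { τ (s , _ , s∈Δ) → v s s∈Δ })
  vd-copy {Δ = Δ} (shed x x∈Δ lk-vd del-vd shedding) =
    shed (ι x) (⁅ x ⁆ , sym (image-⁅⁆ x) , x∈Δ)
      (vd-resp-≐ lk-copy (vd-copy lk-vd)) (vd-resp-≐ del-copy (vd-copy del-vd)) copy-shedding
    where
    copy-shedding : Shedding (copy Δ) (ι x)
    copy-shedding σ σ-facet with isFacet-resp-≐ (≐-sym del-copy) σ-facet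
    ... | facet@((s , refl , _) , _) = isFacet-copy⁺ (shedding s (isFacet-copy⁻ facet))

  -- Stated up to ≐ because links and deletions of copy Δ are copies only up to ≐.
  vd-copy⁻ : ∀ {Γ} → Γ ≐ copy Δ → VertexDecomposable Γ → VertexDecomposable Δ
  vd-copy⁻ (Γ⊆ , ⊆Γ) (simplex (F , faces)) with Γ⊆ (proj₂ (faces F) ⊆-refl)
  ... | s₀ , refl , _ = simplex (s₀ , λ s →
          (λ s∈Δ → image-reflects (proj₁ (faces _) (⊆Γ (s , refl , s∈Δ)))) ,
          (λ s⊆s₀ → copy-image (Γ⊆ (proj₂ (faces _) (image-mono s⊆s₀)))))
  vd-copy⁻ (_ , ⊆Γ) (void v) = void (λ s s∈Δ → v _ (⊆Γ (s , refl , s∈Δ)))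
  vd-copy⁻ {Δ = Δ} Γ≐@(Γ⊆ , _) (shed y y∈Γ lk-vd del-vd shedding) with Γ⊆ y∈Γ
  ... | s , eq , _ with image⊆range (subst (y ∈_) eq (x∈⁅x⁆ y))
  ... | x , refl =
    shed x (copy-image (subst (copy Δ) (sym (image-⁅⁆ x)) (Γ⊆ y∈Γ)))
      (vd-copy⁻ (≐-trans (lk-resp-≐ Γ≐) (≐-sym lk-copy)) lk-vd)
      (vd-copy⁻ (≐-trans (del-resp-≐ Γ≐) (≐-sym del-copy)) del-vd)
      (λ σ → isFacet-copy⁻ ∘ isFacet-resp-≐ Γ≐ ∘ shedding (image σ)
             ∘ isFacet-resp-≐ (≐-trans del-copy (≐-sym (del-resp-≐ Γ≐))) ∘ isFacet-copy⁺)

module _ {n : ℕ} (r : ℕ) (H : SimpleGraph n) where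

  Σᵣ-downClosed : DownClosed (Σᵣ r H)
  Σᵣ-downClosed σ⊆τ (W , ∣W∣≡r , W-connected , τ⊆∁W) = W , ∣W∣≡r , W-connected , ⊆-trans σ⊆τ τ⊆∁W

  Σᵣ-size : ∀ {σ} → Σᵣ r H σ → ∣ σ ∣ ≤ n ∸ r
  Σᵣ-size (W , ∣W∣≡r , _ , σ⊆∁W) =
    ≤-trans (p⊆q⇒∣p∣≤∣q∣ σ⊆∁W) (≤-reflexive (trans (∣∁p∣≡n∸∣p∣ W) (cong (n ∸_) ∣W∣≡r)))

  Σᵣ-proper : ∀ {σ} → Σᵣ r H σ → ¬ (⊤ ⊆ σ)
  Σᵣ-proper (W , _ , ((u , u∈W) , _) , σ⊆∁W) ⊤⊆σ = x∈∁p⇒x∉p (σ⊆∁W (⊤⊆σ ∈⊤)) u∈W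

  Σᵣ-void : ¬ r ≤ n → VertexDecomposable (Σᵣ r H)
  Σᵣ-void r≰n = void (λ _ (W , ∣W∣≡r , _) → r≰n (subst (_≤ n) ∣W∣≡r (∣p∣≤n W)))

reach-end : ∀ {H : SimpleGraph n} {W u v} → Reach H W u v → v ∈ W
reach-end (here v∈W)     = v∈W
reach-end (step _ _ w∈W) = w∈W

module Induced {m n : ℕ} {H : SimpleGraph m} {G : SimpleGraph n} (E : Embedding m n)
               (adj-ι : ∀ i j → adj G (Embedding.ι E i) (Embedding.ι E j) ≡ adj H i j) where
  open Embedding E

  reach-image : ∀ {w i j} → Reach H w i j → Reach G (image w) (ι i) (ι j)
  reach-image (here i∈w)          = here (ι∈image⁺ i∈w)
  reach-image (step walk k~j j∈w) =
    step (reach-image walk) (subst T (sym (adj-ι _ _)) k~j) (ι∈image⁺ j∈w)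

  reach-preimage : ∀ {w u v i j} → Reach G (image w) u v → u ≡ ι i → v ≡ ι j → Reach H w i j
  reach-preimage (here u∈) refl ιi≡ιj = subst (Reach H _ _) (ι-injective E ιi≡ιj) (here (ι∈image⁻ u∈))
  reach-preimage (step walk v~w w∈) refl refl with image⊆range (reach-end walk)
  ... | k , refl = step (reach-preimage walk refl refl) (subst T (adj-ι k _) v~w) (ι∈image⁻ w∈)

  connected-image : ∀ {w} → InducedConnected H w → InducedConnected G (image w)
  connected-image ((i , i∈w) , connected) = (ι i , ι∈image⁺ i∈w) , reach
    where
    reach : ∀ u v → u ∈ image _ → v ∈ image _ → Reach G (image _) u v
    reach u v u∈ v∈ with image⊆range u∈ | image⊆range v∈
    ... | _ , refl | _ , refl = reach-image (connected _ _ (ι∈image⁻ u∈) (ι∈image⁻ v∈))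

  connected-preimage : ∀ {w} → InducedConnected G (image w) → InducedConnected H w
  connected-preimage ((u , u∈) , connected) with image⊆range u∈
  ... | i , refl = (i , ι∈image⁻ u∈) ,
                   λ i j i∈ j∈ → reach-preimage (connected _ _ (ι∈image⁺ i∈) (ι∈image⁺ j∈)) refl refl

  ⊆range : (∀ {y} → y ∉ image ⊤ → y ∈ τ) → Disjoint σ τ → σ ⊆ image ⊤
  ⊆range rest⊆τ σ#τ {y} y∈σ = decidable-stable (y ∈? image ⊤) (σ#τ y∈σ ∘ rest⊆τ)

  Σᵣ-image : ∀ {r s σ} → Σᵣ r H s → (∀ {i} → ι i ∈ σ → i ∈ s) → Σᵣ r G σ
  Σᵣ-image {σ = σ} (w , ∣w∣≡r , w-connected , s⊆∁w) σ⊆s =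
    image w , trans (∣image∣ w) ∣w∣≡r , connected-image w-connected , x∉p⇒x∈∁p ∘ σ#W
    where
    σ#W : Disjoint σ (image w)
    σ#W y∈σ y∈W with image⊆range y∈W
    ... | _ , refl = x∈∁p⇒x∉p (s⊆∁w (σ⊆s y∈σ)) (ι∈image⁻ y∈W)

  Σᵣ-preimage : ∀ {r s σ} → Σᵣ r G σ → (∀ {y} → y ∉ image ⊤ → y ∈ σ) → (∀ {i} → i ∈ s → ι i ∈ σ) →
                Σᵣ r H s
  Σᵣ-preimage (W , ∣W∣≡r , W-connected , σ⊆∁W) rest⊆σ s⊆σ
    with ⊆image (⊆range rest⊆σ (λ y∈W y∈σ → x∈∁p⇒x∉p (σ⊆∁W y∈σ) y∈W))
  ... | w , refl = w , trans (sym (∣image∣ w)) ∣W∣≡r , connected-preimage W-connected ,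
                   λ i∈s → x∉p⇒x∈∁p (x∈∁p⇒x∉p (σ⊆∁W (s⊆σ i∈s)) ∘ ι∈image⁺)

  Σᵣ⇒copy : ∀ {r σ} → (∀ {y} → y ∉ image ⊤ → y ∈ σ) → Σᵣ r G σ → copy E (Σᵣ r H) (σ ∩ image ⊤)
  Σᵣ⇒copy {σ = σ} rest⊆σ σ∈Σ with ⊆image (p∩q⊆q σ (image ⊤))
  ... | s , eq = s , eq , Σᵣ-preimage σ∈Σ rest⊆σ (p∩q⊆p σ _ ∘ subst (_ ∈_) (sym eq) ∘ ι∈image⁺)

  copy⇒Σᵣ : ∀ {r σ} → copy E (Σᵣ r H) (σ ∩ image ⊤) → Σᵣ r G σ
  copy⇒Σᵣ (s , eq , s∈Σ) =
    Σᵣ-image s∈Σ (λ ιi∈σ → ι∈image⁻ (subst (_ ∈_) eq (x∈p∩q⁺ (ιi∈σ , ι∈image⁺ ∈⊤))))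

  lkSet-Σᵣ : ∀ {r C} → Disjoint (image ⊤) C → (∀ {y} → y ∉ image ⊤ → y ∈ C) →
             lkSet (Σᵣ r G) C ≐ copy E (Σᵣ r H)
  lkSet-Σᵣ {C = C} V#C rest⊆C = to , from
    where
    to : ∀ {ρ} → lkSet (Σᵣ _ G) C ρ → copy E (Σᵣ _ H) ρ
    to {ρ} (ρ#C , ρC∈Σ) with ⊆image (⊆range rest⊆C ρ#C)
    ... | s , refl = s , refl , Σᵣ-preimage ρC∈Σ (q⊆p∪q ρ C ∘ rest⊆C) (p⊆p∪q C ∘ ι∈image⁺)
    from : ∀ {ρ} → copy E (Σᵣ _ H) ρ → lkSet (Σᵣ _ G) C ρ
    from (s , refl , s∈Σ) =
      V#C ∘ image-mono E ⊆⊤ ,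
      Σᵣ-image s∈Σ (λ ιi∈ → [ ι∈image⁻ , ⊥-elim ∘ V#C (ι∈image⁺ ∈⊤) ] (x∈p∪q⁻ _ C ιi∈))

-- The join of two graphs

↑ˡ∈++⁺ : ∀ {s : Subset m} {t : Subset n} {i} → i ∈ s → i ↑ˡ n ∈ s ++ t
↑ˡ∈++⁺ {s = _ ∷ _} {i = zero}  here      = here
↑ˡ∈++⁺ {s = _ ∷ _} {i = suc i} (there h) = there (↑ˡ∈++⁺ h)

↑ˡ∈++⁻ : ∀ {s : Subset m} {t : Subset n} {i} → i ↑ˡ n ∈ s ++ t → i ∈ s
↑ˡ∈++⁻ {s = _ ∷ _} {i = zero}  here      = here
↑ˡ∈++⁻ {s = _ ∷ _} {i = suc i} (there h) = there (↑ˡ∈++⁻ h)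

↑ʳ∈++⁺ : ∀ (s : Subset m) {t : Subset n} {j} → j ∈ t → m ↑ʳ j ∈ s ++ t
↑ʳ∈++⁺ []      h = h
↑ʳ∈++⁺ (_ ∷ s) h = there (↑ʳ∈++⁺ s h)

↑ʳ∈++⁻ : ∀ (s : Subset m) {t : Subset n} {j} → m ↑ʳ j ∈ s ++ t → j ∈ t
↑ʳ∈++⁻ []      h         = h
↑ʳ∈++⁻ (_ ∷ s) (there h) = ↑ʳ∈++⁻ s h

∣p++q∣≡∣p∣+∣q∣ : ∀ (p : Subset m) (q : Subset n) → ∣ p ++ q ∣ ≡ ∣ p ∣ + ∣ q ∣
∣p++q∣≡∣p∣+∣q∣ []          q = refl
∣p++q∣≡∣p∣+∣q∣ (true ∷ p)  q = cong suc (∣p++q∣≡∣p∣+∣q∣ p q)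
∣p++q∣≡∣p∣+∣q∣ (false ∷ p) q = ∣p++q∣≡∣p∣+∣q∣ p q

↑ˡ-or-↑ʳ : ∀ m (k : Fin (m + n)) → (∃ λ i → k ≡ i ↑ˡ n) ⊎ (∃ λ j → k ≡ m ↑ʳ j)
↑ˡ-or-↑ʳ m k with splitAt m k in eq
... | inj₁ i = inj₁ (i , sym (splitAt⁻¹-↑ˡ eq))
... | inj₂ j = inj₂ (j , sym (splitAt⁻¹-↑ʳ eq))

module _ (n₁ n₂ : ℕ) where

  ↑ˡ-embedding : Embedding n₁ (n₁ + n₂)
  ↑ˡ-embedding = record
    { ι = _↑ˡ n₂ ; image = _++ ⊥ ; ι∈image⁺ = ↑ˡ∈++⁺ ; ι∈image⁻ = ↑ˡ∈++⁻
    ; image⊆range = range ; ⊆image = ⊆image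
    ; ∣image∣ = λ s → trans (∣p++q∣≡∣p∣+∣q∣ s ⊥) (trans (cong (∣ s ∣ +_) (∣⊥∣≡0 n₂)) (+-identityʳ _)) }
    where
    range : ∀ {y} {s : Subset n₁} → y ∈ s ++ ⊥ → ∃ λ i → y ≡ i ↑ˡ n₂
    range {y} {s} y∈ with ↑ˡ-or-↑ʳ n₁ y
    ... | inj₁ i↑ = i↑
    ... | inj₂ (j , refl) = ⊥-elim (∉⊥ (↑ʳ∈++⁻ s y∈))
    ⊆image : ∀ {τ} {s : Subset n₁} → τ ⊆ s ++ ⊥ → ∃ λ t → τ ≡ t ++ ⊥
    ⊆image {τ} {s} τ⊆ with Vec.splitAt n₁ τ
    ... | a , b , refl = a , cong (a ++_) (Empty-unique λ (j , j∈b) → ∉⊥ (↑ʳ∈++⁻ s (τ⊆ (↑ʳ∈++⁺ a j∈b))))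

  ↑ʳ-embedding : Embedding n₂ (n₁ + n₂)
  ↑ʳ-embedding = record
    { ι = n₁ ↑ʳ_ ; image = ⊥ ++_ ; ι∈image⁺ = ↑ʳ∈++⁺ ⊥ ; ι∈image⁻ = ↑ʳ∈++⁻ ⊥
    ; image⊆range = range ; ⊆image = ⊆image
    ; ∣image∣ = λ t → trans (∣p++q∣≡∣p∣+∣q∣ (⊥ {n₁}) t) (cong (_+ ∣ t ∣) (∣⊥∣≡0 n₁)) }
    where
    range : ∀ {y} {t : Subset n₂} → y ∈ ⊥ ++ t → ∃ λ j → y ≡ n₁ ↑ʳ j
    range {y} y∈ with ↑ˡ-or-↑ʳ n₁ y
    ... | inj₁ (i , refl) = ⊥-elim (∉⊥ (↑ˡ∈++⁻ y∈))
    ... | inj₂ j↑ = j↑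
    ⊆image : ∀ {τ} {t : Subset n₂} → τ ⊆ ⊥ ++ t → ∃ λ u → τ ≡ ⊥ ++ u
    ⊆image {τ} τ⊆ with Vec.splitAt n₁ τ
    ... | a , b , refl = b , cong (_++ b) (Empty-unique λ (i , i∈a) → ∉⊥ (↑ˡ∈++⁻ (τ⊆ (↑ˡ∈++⁺ i∈a))))

module Join {n₁ n₂ : ℕ} (G₁ : SimpleGraph n₁) (G₂ : SimpleGraph n₂) where
  G : SimpleGraph (n₁ + n₂)
  G = G₁ *ᴳ G₂

  V₁ V₂ : Subset (n₁ + n₂)
  V₁ = Embedding.image (↑ˡ-embedding n₁ n₂) ⊤
  V₂ = Embedding.image (↑ʳ-embedding n₁ n₂) ⊤

  adj-↑ˡ : ∀ i j → adj G (i ↑ˡ n₂) (j ↑ˡ n₂) ≡ adj G₁ i j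
  adj-↑ˡ i j rewrite splitAt-↑ˡ n₁ i n₂ | splitAt-↑ˡ n₁ j n₂ = refl

  adj-↑ʳ : ∀ i j → adj G (n₁ ↑ʳ i) (n₁ ↑ʳ j) ≡ adj G₂ i j
  adj-↑ʳ i j rewrite splitAt-↑ʳ n₁ n₂ i | splitAt-↑ʳ n₁ n₂ j = refl

  adj-↑ˡ↑ʳ : ∀ i j → T (adj G (i ↑ˡ n₂) (n₁ ↑ʳ j))
  adj-↑ˡ↑ʳ i j rewrite splitAt-↑ˡ n₁ i n₂ | splitAt-↑ʳ n₁ n₂ j = tt

  module L = Induced {H = G₁} {G = G} (↑ˡ-embedding n₁ n₂) adj-↑ˡ
  module R = Induced {H = G₂} {G = G} (↑ʳ-embedding n₁ n₂) adj-↑ʳ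

  V₁-or-V₂ : ∀ y → y ∈ V₁ ⊎ y ∈ V₂
  V₁-or-V₂ y with ↑ˡ-or-↑ʳ n₁ y
  ... | inj₁ (i , refl) = inj₁ (↑ˡ∈++⁺ (∈⊤ {x = i}))
  ... | inj₂ (j , refl) = inj₂ (↑ʳ∈++⁺ ⊥ (∈⊤ {x = j}))

  ∉V₁⇒∈V₂ : ∀ {y} → y ∉ V₁ → y ∈ V₂
  ∉V₁⇒∈V₂ {y} y∉V₁ = [ ⊥-elim ∘ y∉V₁ , id ]′ (V₁-or-V₂ y)

  ∉V₂⇒∈V₁ : ∀ {y} → y ∉ V₂ → y ∈ V₁
  ∉V₂⇒∈V₁ {y} y∉V₂ = [ id , ⊥-elim ∘ y∉V₂ ]′ (V₁-or-V₂ y)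

  V₁#V₂ : Disjoint V₁ V₂
  V₁#V₂ {y} y∈V₁ y∈V₂ with ↑ˡ-or-↑ʳ n₁ y
  ... | inj₁ (i , refl) = ∉⊥ (↑ˡ∈++⁻ y∈V₂)
  ... | inj₂ (j , refl) = ∉⊥ (↑ʳ∈++⁻ (⊤ {n₁}) y∈V₁)

  V₂#V₁ : Disjoint V₂ V₁
  V₂#V₁ y∈V₂ y∈V₁ = V₁#V₂ y∈V₁ y∈V₂

  adj-across : ∀ {a b} → a ∈ V₁ → b ∈ V₂ → T (adj G a b)
  adj-across a∈V₁ b∈V₂ with Embedding.image⊆range (↑ˡ-embedding n₁ n₂) a∈V₁
                           | Embedding.image⊆range (↑ʳ-embedding n₁ n₂) b∈V₂
  ... | i , refl | j , refl = adj-↑ˡ↑ʳ i j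

  adj-across′ : ∀ {a b} → a ∈ V₁ → b ∈ V₂ → T (adj G b a)
  adj-across′ {a} {b} a∈V₁ b∈V₂ = subst T (symm G a b) (adj-across a∈V₁ b∈V₂)

  connected-across : ∀ {a b W} → a ∈ V₁ → b ∈ V₂ → a ∈ W → b ∈ W → InducedConnected G W
  connected-across {a} {b} {W} a∈V₁ b∈V₂ a∈W b∈W = (a , a∈W) , reach
    where
    reach : ∀ u v → u ∈ W → v ∈ W → Reach G W u v
    reach u v u∈W v∈W with V₁-or-V₂ u | V₁-or-V₂ v
    ... | inj₁ u∈V₁ | inj₁ v∈V₁ =
      step (step (here u∈W) (adj-across u∈V₁ b∈V₂) b∈W) (adj-across′ v∈V₁ b∈V₂) v∈W
    ... | inj₁ u∈V₁ | inj₂ v∈V₂ = step (here u∈W) (adj-across u∈V₁ v∈V₂) v∈W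
    ... | inj₂ u∈V₂ | inj₁ v∈V₁ = step (here u∈W) (adj-across′ v∈V₁ u∈V₂) v∈W
    ... | inj₂ u∈V₂ | inj₂ v∈V₂ =
      step (step (here u∈W) (adj-across′ a∈V₁ u∈V₂) a∈W) (adj-across a∈V₁ v∈V₂) v∈W

  Σᵣ-across : ∀ {r σ a b} → 2 ≤ r → r ≤ n₁ + n₂ → ∣ σ ∣ ≤ n₁ + n₂ ∸ r →
              a ∈ V₁ → b ∈ V₂ → a ∉ σ → b ∉ σ → Σᵣ r G σ
  Σᵣ-across {r} {σ} {a} {b} 2≤r r≤n ∣σ∣≤n-r a∈V₁ b∈V₂ a∉σ b∉σ
    with ∃-between (⁅ a ⁆ ∪ ⁅ b ⁆) (∁ σ) r (∪-least (⁅x⁆⊆p (x∉p⇒x∈∁p a∉σ)) (⁅x⁆⊆p (x∉p⇒x∈∁p b∉σ)))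
                   (subst (_≤ r) (sym ∣ab∣≡2) 2≤r) r≤∣∁σ∣
    where
    ∣ab∣≡2 : ∣ ⁅ a ⁆ ∪ ⁅ b ⁆ ∣ ≡ 2
    ∣ab∣≡2 = trans (∣p∪⁅x⁆∣≡1+∣p∣ ⁅ a ⁆ (λ b∈⁅a⁆ → ⁅x⁆#p (V₁#V₂ a∈V₁) b∈⁅a⁆ b∈V₂))
                   (cong suc (∣⁅x⁆∣≡1 a))
    r≤∣∁σ∣ : r ≤ ∣ ∁ σ ∣
    r≤∣∁σ∣ = subst (r ≤_) (sym (∣∁p∣≡n∸∣p∣ σ))
               (subst (_≤ n₁ + n₂ ∸ ∣ σ ∣) (m∸[m∸n]≡n r≤n) (∸-monoʳ-≤ (n₁ + n₂) ∣σ∣≤n-r))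
  ... | W , ab⊆W , W⊆∁σ , ∣W∣≡r =
    W , ∣W∣≡r ,
    connected-across a∈V₁ b∈V₂ (ab⊆W (p⊆p∪q ⁅ b ⁆ (x∈⁅x⁆ a))) (ab⊆W (q⊆p∪q ⁅ a ⁆ ⁅ b ⁆ (x∈⁅x⁆ b))) ,
    λ y∈σ → x∉p⇒x∈∁p (λ y∈W → x∈∁p⇒x∉p (W⊆∁σ y∈W) y∈σ)

  module _ (r : ℕ) where
    Σ₁ Σ₂ : Complex (n₁ + n₂)
    Σ₁ = copy (↑ˡ-embedding n₁ n₂) (Σᵣ r G₁)
    Σ₂ = copy (↑ʳ-embedding n₁ n₂) (Σᵣ r G₂)

    Σᵣ-join : 2 ≤ r → r ≤ n₁ + n₂ → Σᵣ r G ≐ JoinComplex V₁ V₂ Σ₁ Σ₂ (n₁ + n₂ ∸ r)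
    Σᵣ-join 2≤r r≤n = to , from
      where
      to : ∀ {σ} → Σᵣ r G σ → JoinComplex V₁ V₂ Σ₁ Σ₂ (n₁ + n₂ ∸ r) σ
      to {σ} σ∈Σ = (λ {y} _ → [ p⊆p∪q V₂ , q⊆p∪q V₁ V₂ ]′ (V₁-or-V₂ y)) , Σᵣ-size r G σ∈Σ ,
                   admissible (V₁ ⊆? σ) (V₂ ⊆? σ)
        where
        admissible : Dec (V₁ ⊆ σ) → Dec (V₂ ⊆ σ) → Admissible V₁ V₂ Σ₁ Σ₂ σ
        admissible (yes V₁⊆σ) (yes V₂⊆σ) =
          ⊥-elim (Σᵣ-proper r G σ∈Σ (λ {y} _ → [ V₁⊆σ , V₂⊆σ ]′ (V₁-or-V₂ y)))
        admissible (no V₁⊈σ)  (yes V₂⊆σ) = left V₂⊆σ V₁⊈σ (L.Σᵣ⇒copy (V₂⊆σ ∘ ∉V₁⇒∈V₂) σ∈Σ)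
        admissible (yes V₁⊆σ) (no V₂⊈σ)  = right V₁⊆σ V₂⊈σ (R.Σᵣ⇒copy (V₁⊆σ ∘ ∉V₂⇒∈V₁) σ∈Σ)
        admissible (no V₁⊈σ)  (no V₂⊈σ)  = mixed V₁⊈σ V₂⊈σ
      from : ∀ {σ} → JoinComplex V₁ V₂ Σ₁ Σ₂ (n₁ + n₂ ∸ r) σ → Σᵣ r G σ
      from (_ , ∣σ∣≤n-r , mixed V₁⊈σ V₂⊈σ) with ⊈⇒∃∉ V₁⊈σ | ⊈⇒∃∉ V₂⊈σ
      ... | a , a∈V₁ , a∉σ | b , b∈V₂ , b∉σ = Σᵣ-across 2≤r r≤n ∣σ∣≤n-r a∈V₁ b∈V₂ a∉σ b∉σ
      from (_ , _ , left _ _ σ∈Σ₁)  = L.copy⇒Σᵣ σ∈Σ₁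
      from (_ , _ , right _ _ σ∈Σ₂) = R.copy⇒Σᵣ σ∈Σ₂

    joinData : VertexDecomposable (Σᵣ r G₁) → VertexDecomposable (Σᵣ r G₂) → JoinData V₁ V₂ Σ₁ Σ₂
    joinData vd₁ vd₂ = record
      { disjoint = V₁#V₂
      ; P-vd = vd-copy (↑ˡ-embedding n₁ n₂) vd₁ ; Q-vd = vd-copy (↑ʳ-embedding n₁ n₂) vd₂
      ; P-closed = copy-downClosed (↑ˡ-embedding n₁ n₂) (Σᵣ-downClosed r G₁)
      ; Q-closed = copy-downClosed (↑ʳ-embedding n₁ n₂) (Σᵣ-downClosed r G₂)
      ; P-supported = copy-supported (↑ˡ-embedding n₁ n₂)
      ; Q-supported = copy-supported (↑ʳ-embedding n₁ n₂) }

    vd-Σᵣ : 2 ≤ r → r ≤ n₁ + n₂ → VertexDecomposable (Σᵣ r G₁) → VertexDecomposable (Σᵣ r G₂) →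
            VertexDecomposable (Σᵣ r G)
    vd-Σᵣ 2≤r r≤n vd₁ vd₂ =
      vd-resp-≐ (≐-sym (Σᵣ-join 2≤r r≤n)) (joinComplex-vd (joinData vd₁ vd₂) (n₁ + n₂ ∸ r))

    vd-Σᵣ₁ : VertexDecomposable (Σᵣ r G) → VertexDecomposable (Σᵣ r G₁)
    vd-Σᵣ₁ vd = vd-copy⁻ (↑ˡ-embedding n₁ n₂) (L.lkSet-Σᵣ V₁#V₂ ∉V₁⇒∈V₂)
                         (vd⇒vd-lkSet (Σᵣ-downClosed r G) vd V₂)

    vd-Σᵣ₂ : VertexDecomposable (Σᵣ r G) → VertexDecomposable (Σᵣ r G₂)
    vd-Σᵣ₂ vd = vd-copy⁻ (↑ʳ-embedding n₁ n₂) (R.lkSet-Σᵣ V₂#V₁ ∉V₂⇒∈V₁)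
                         (vd⇒vd-lkSet (Σᵣ-downClosed r G) vd V₁)

theorem3p14 : (r : ℕ) → 2 ≤ r → ∀ {n₁ n₂} (G₁ : SimpleGraph n₁) (G₂ : SimpleGraph n₂) →
    VertexDecomposable (Σᵣ r (G₁ *ᴳ G₂)) ⇔
      (VertexDecomposable (Σᵣ r G₁) × VertexDecomposable (Σᵣ r G₂))
theorem3p14 r 2≤r {n₁} {n₂} G₁ G₂ with r ≤? n₁ + n₂
... | yes r≤n = mk⇔ (λ vd → vd-Σᵣ₁ r vd , vd-Σᵣ₂ r vd) (λ (vd₁ , vd₂) → vd-Σᵣ r 2≤r r≤n vd₁ vd₂)
  where open Join G₁ G₂
... | no r≰n = mk⇔ (λ _ → Σᵣ-void r G₁ (r≰n ∘ λ r≤n₁ → ≤-trans r≤n₁ (m≤m+n n₁ n₂)) ,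
                          Σᵣ-void r G₂ (r≰n ∘ λ r≤n₂ → ≤-trans r≤n₂ (m≤n+m n₂ n₁)))
                   (λ _ → Σᵣ-void r (G₁ *ᴳ G₂) r≰n)
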